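{- For every $n\geq 0$, the map $\phi$ is a bijection from plane alternative forests labeled by $\{1,\dots,n\}$ to alternative arc diagrams on the points $\{0,1,\dots,n+1\}$.
   Context: A vertex of a labeled rooted tree is minimal (maximal) if its label is smaller (larger) than the labels of all its descendants. A plane alternative tree is a rooted plane tree with pairwise distinct integer labels and black/white vertices such that: - every white vertex is minimal, and its children are black with labels decreasing from left to right; - every black vertex is maximal, and its children are white with labels increasing from left to right. A plane alternative forest is a set of plane alternative trees with pairwise disjoint label sets. An arc diagram on a finite label set $L\subset\mathbb{Z}$ consists of points labeled by $L$, placed on a horizontal line increasingly from left to right, together with a set of arcs $(i,j)$ with $i<j$ in $L$ (a simple loopless graph on $L$). An arc $(i,j)$, $i<j$: - is topmost at its left endpoint $i$ if there is no arc $(i,\ell)$ with $\ell>j$; - is topmost at its right endpoint $j$ if there is no arc $(k,j)$ with $k<i$. Let $|L|\geq 2$ with minimum $m$ and maximum $M$. An arc diagram on $L$ is alternative if: - (1) no point $i$ has both an arc $(k,i)$ with $k<i$ and an arc $(i,j)$ with $j>i$; - (2) as a graph it is a tree; - (3) every arc other than $(m,M)$ is topmost at exactly one of its two endpoints. For a plane alternative forest $F$ labeled by $\{1,\dots,n\}$, $\phi(F)$ is the arc diagram on $\{0,\dots,n+1\}$ with the following arcs: - an arc $\{i,j\}$ for each edge of $F$; - an arc $(0,b)$ for each black root $b$; - an arc $(w,n+1)$ for each white root $w$; - the arc $(0,n+1)$. -}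

module Defs where

open import Data.Nat using (ℕ; zero; suc; _<_; _≤_; _⊓_; _⊔_)
open import Data.List using (List; []; _∷_; _++_; map; upTo; length)
open import Data.List.Relation.Unary.All using (All)
open import Data.List.Relation.Unary.Unique.Propositional using (Unique)
open import Data.List.Relation.Unary.Linked using (Linked)
open import Data.List.Relation.Binary.Permutation.Propositional using (_↭_)
open import Data.List.Membership.Propositional using (_∈_)
open import Data.Product using (_×_; _,_; ∃; ∃-syntax; Σ)
open import Data.Sum using (_⊎_)
open import Relation.Nullary using (¬_)
open import Relation.Binary.PropositionalEquality using (_≡_)
open import Function.Bundles using (_⇔_)

-- Plane (ordered) rooted trees with black/white vertices and ℕ labels.
-- The list of children is ordered from left to right.

data Color : Set where
  white black : Color

data PTree : Set where
  node : Color → ℕ → List PTree → PTree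

color : PTree → Color
color (node c _ _) = c

root : PTree → ℕ
root (node _ l _) = l

mutual
  labels : PTree → List ℕ
  labels (node _ l ts) = l ∷ labelsF ts

  labelsF : List PTree → List ℕ
  labelsF []       = []
  labelsF (t ∷ ts) = labels t ++ labelsF ts

data AltTree : PTree → Set where
  white-node : ∀ {l ts} →
    All (λ m → l < m) (labelsF ts) →
    All (λ t → color t ≡ black) ts →
    Linked (λ a b → b < a) (map root ts) →
    All AltTree ts →
    AltTree (node white l ts)
  black-node : ∀ {l ts} →
    All (λ m → m < l) (labelsF ts) →
    All (λ t → color t ≡ white) ts →
    Linked _<_ (map root ts) →
    All AltTree ts →
    AltTree (node black l ts)

-- The forest is a *set* of trees; we represent it by a list,
-- and identify lists up to permutation (_↭_).
AltForest : ℕ → List PTree → Set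
AltForest n F = All AltTree F × (labelsF F ↭ map suc (upTo n))

-- Arc diagrams on {0,…,n+1}: a finite set of arcs (i , j) with i < j,
-- represented by a list; two diagrams are equal when they have the same
-- arcs (set equality).

Arc : Set
Arc = ℕ × ℕ

ArcDiagram : ℕ → List Arc → Set
ArcDiagram n A = All (λ a → (Data.Product.proj₁ a < Data.Product.proj₂ a) × (Data.Product.proj₂ a ≤ suc n)) A

_≈A_ : List Arc → List Arc → Set
A ≈A B = ∀ (a : Arc) → (a ∈ A) ⇔ (a ∈ B)

Adj : List Arc → ℕ → ℕ → Set
Adj A u v = ((u , v) ∈ A) ⊎ ((v , u) ∈ A)

data Reach (A : List Arc) (u : ℕ) : ℕ → Set where
  here : Reach A u u
  step : ∀ {v w} → Reach A u v → Adj A v w → Reach A u w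

data Cycle (A : List Arc) : Set where
  cycle : ∀ v vs w →
    1 ≤ length vs →
    Unique (v ∷ vs ++ w ∷ []) →
    Linked (Adj A) (v ∷ vs ++ w ∷ []) →
    Adj A w v →
    Cycle A

IsTree : ℕ → List Arc → Set
IsTree n A = (∀ u v → u ≤ suc n → v ≤ suc n → Reach A u v) × ¬ Cycle A

TopmostLeft : List Arc → ℕ → ℕ → Set
TopmostLeft A i j = ¬ (∃[ ℓ ] (j < ℓ × (i , ℓ) ∈ A))

TopmostRight : List Arc → ℕ → ℕ → Set
TopmostRight A i j = ¬ (∃[ k ] (k < i × (k , j) ∈ A))

-- alternative arc diagram on {0,…,n+1}  (m = 0, M = n+1)
AltDiagram : ℕ → List Arc → Set
AltDiagram n A =
  ArcDiagram n A ×
  -- (1)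
  (∀ k i j → (k , i) ∈ A → (i , j) ∈ A → Data.Empty.⊥) ×
  -- (2)
  IsTree n A ×
  -- (3)
  (∀ i j → (i , j) ∈ A → ¬ ((i , j) ≡ (0 , suc n)) →
     (TopmostLeft A i j × ¬ TopmostRight A i j) ⊎
     (¬ TopmostLeft A i j × TopmostRight A i j))
  where import Data.Empty

mutual
  edges : PTree → List Arc
  edges (node _ l ts) = map (λ t → (l ⊓ root t , l ⊔ root t)) ts ++ edgesF ts

  edgesF : List PTree → List Arc
  edgesF []       = []
  edgesF (t ∷ ts) = edges t ++ edgesF ts

rootArcs : ℕ → List PTree → List Arc
rootArcs n []                    = []
rootArcs n (node white w _ ∷ ts) = (w , suc n) ∷ rootArcs n ts
rootArcs n (node black b _ ∷ ts) = (0 , b) ∷ rootArcs n ts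

φ : ℕ → List PTree → List Arc
φ n F = (0 , suc n) ∷ (rootArcs n F ++ edgesF F)

-- Every vertex s of a forest is recorded as an *entry* (p , s): s with the
-- label p of its parent, white (black) roots hanging from n+1 (resp. 0).
-- The arcs of φ F are the top arc (0 , n+1) and one arc per entry.
-- (A) φ F is alternative: (1) and (3) follow from the colouring rules, as an
--     entry's arc is topmost exactly at the child; for (2) every vertex is
--     joined to 0, and acyclicity follows from a general criterion
--     (ParentAcyclic): edges join vertices to unique parents and the
--     distance to the parent grows along parent chains.
-- (B) A reconstruction ψ, reading only an arc oracle, rebuilds each tree
--     recursively; ψ (φ F) ↭ F, so φ is injective up to order.
-- (C) For an alternative D, the parent of a point is the other end of the
--     arc topmost at it; ψ applied to D is an alternative forest whose
--     entries give exactly the arcs of D.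
module Submission where

open import Defs
open import Data.Nat using (ℕ; zero; suc; _<_; _≤_; _+_; _∸_; z≤n; s≤s; s≤s⁻¹; s<s⁻¹; _⊓_; _⊔_; _≟_; _<?_; ∣_-_∣)
open import Data.Nat.Properties
open import Data.Bool using (Bool; true; false)
open import Data.List using (List; []; _∷_; _++_; map; upTo)
open import Data.List.Properties using (map-++; ++-assoc)
open import Data.List.Relation.Unary.All using (All; []; _∷_)
import Data.List.Relation.Unary.All as All
import Data.List.Relation.Unary.All.Properties as AP
open import Data.List.Relation.Unary.Any using (here; there)
open import Data.List.Relation.Unary.AllPairs using ([]; _∷_)
import Data.List.Relation.Unary.AllPairs as AllPairs
open import Data.List.Relation.Unary.Linked using (Linked; []; [-]; _∷_)
import Data.List.Relation.Unary.Linked as Linked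
import Data.List.Relation.Unary.Linked.Properties as LP
open import Data.List.Relation.Unary.Unique.Propositional using (Unique)
import Data.List.Relation.Unary.Unique.Propositional.Properties as UP
open import Data.List.Membership.Propositional using (_∈_)
open import Data.List.Membership.Propositional.Properties
import Data.List.Membership.DecPropositional as DecMem
open import Data.List.Membership.Propositional.Properties.WithK using (unique∧set⇒bag)
open import Data.List.Relation.Binary.BagAndSetEquality using (∼bag⇒↭)
open import Data.List.Relation.Binary.Permutation.Propositional using (_↭_; ↭-sym; ↭-trans; ↭-reflexive; ↭⇒↭ₛ)
open import Data.List.Relation.Binary.Permutation.Propositional.Properties using (∈-resp-↭)
import Data.List.Relation.Binary.Permutation.Setoid.Properties as PermProps
open import Data.Product using (_×_; _,_; ∃-syntax; proj₁; proj₂)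
open import Data.Product.Properties using (≡-dec)
open import Data.Sum using (_⊎_; inj₁; inj₂)
open import Data.Empty using (⊥; ⊥-elim)
open import Relation.Nullary using (¬_; Dec; yes; no)
open import Relation.Nullary.Decidable using (isYes; _×-dec_)
open import Relation.Binary.Definitions using (tri<; tri≈; tri>)
open import Relation.Binary.PropositionalEquality using (_≡_; _≢_; refl; sym; trans; cong; cong₂; subst; setoid)
open import Function.Bundles using (mk⇔; Equivalence)
open import Function using (case_of_)

unique⇒map-injective : ∀ {A B : Set} (f : A → B) {xs : List A} → Unique (map f xs) →
                       ∀ {x y} → x ∈ xs → y ∈ xs → f x ≡ f y → x ≡ y
unique⇒map-injective f {z ∷ zs} (_ ∷ _) (here refl) (here refl) e = refl
unique⇒map-injective f {z ∷ zs} (a ∷ _) (here refl) (there q) e =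
  ⊥-elim (All.lookup a (∈-map⁺ f q) e)
unique⇒map-injective f {z ∷ zs} (a ∷ _) (there p) (here refl) e =
  ⊥-elim (All.lookup a (∈-map⁺ f p) (sym e))
unique⇒map-injective f {z ∷ zs} (_ ∷ u) (there p) (there q) e = unique⇒map-injective f u p q e

unique-++⁻ : ∀ {A : Set} (xs : List A) {ys} → Unique (xs ++ ys) → Unique xs × Unique ys
unique-++⁻ [] u = [] , u
unique-++⁻ (x ∷ xs) (a ∷ u) with unique-++⁻ xs u
... | u1 , u2 = (AP.++⁻ˡ xs a ∷ u1) , u2

unique-++⇒disjoint : ∀ {A : Set} (xs : List A) {ys} → Unique (xs ++ ys) → ∀ {z} → z ∈ xs → z ∈ ys → ⊥
unique-++⇒disjoint (x ∷ xs) (a ∷ u) (here refl) q = All.lookup (AP.++⁻ʳ xs a) q refl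
unique-++⇒disjoint (x ∷ xs) (a ∷ u) (there p) q = unique-++⇒disjoint xs u p q

Unique-resp-↭ : ∀ {A : Set} {xs ys : List A} → xs ↭ ys → Unique xs → Unique ys
Unique-resp-↭ {A} p = PermProps.Unique-resp-↭ (setoid A) (↭⇒↭ₛ p)

unique-sameElements⇒↭ : ∀ {A : Set} {xs ys : List A} → Unique xs → Unique ys →
                        (∀ z → z ∈ xs → z ∈ ys) → (∀ z → z ∈ ys → z ∈ xs) → xs ↭ ys
unique-sameElements⇒↭ u1 u2 f g = ∼bag⇒↭ (unique∧set⇒bag u1 u2 (mk⇔ (f _) (g _)))

linked⇒unique : ∀ {R : ℕ → ℕ → Set} → (∀ {a b} → R a b → a ≢ b) → (∀ {a b c} → R a b → R b c → R a c) →
                ∀ {xs} → Linked R xs → Unique xs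
linked⇒unique irr tr l = AllPairs.map irr (LP.Linked⇒AllPairs tr l)

Linked⇒All-head : ∀ {R : ℕ → ℕ → Set} → (∀ {a b c} → R a b → R b c → R a c) →
                  ∀ {x xs} → Linked R (x ∷ xs) → All (R x) xs
Linked⇒All-head tr l = AllPairs.head (LP.Linked⇒AllPairs tr l)

Linked-cons : ∀ {R : ℕ → ℕ → Set} {x xs} → All (R x) xs → Linked R xs → Linked R (x ∷ xs)
Linked-cons [] [] = [-]
Linked-cons (r ∷ _) l = r ∷ l

Adj-sym : ∀ {A u v} → Adj A u v → Adj A v u
Adj-sym (inj₁ x) = inj₂ x
Adj-sym (inj₂ y) = inj₁ y

Reach-trans : ∀ {A u v w} → Reach A u v → Reach A v w → Reach A u w
Reach-trans r here = r
Reach-trans r (step q a) = step (Reach-trans r q) a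

Reach-sym : ∀ {A u v} → Reach A u v → Reach A v u
Reach-sym here = here
Reach-sym (step r a) = Reach-trans (step here (Adj-sym a)) (Reach-sym r)

-- Bounded search for decidable predicates on ℕ; it turns the negated
-- "topmost" conditions of a diagram into explicit arcs.

search-below : ∀ {P : ℕ → Set} → (∀ x → Dec (P x)) → ∀ k → Dec (∃[ x ] (x < k × P x))
search-below P? zero = no λ { (x , () , _) }
search-below P? (suc k) with P? k
... | yes p = yes (k , ≤-refl , p)
... | no np with search-below P? k
...   | yes (x , x<k , px) = yes (x , m≤n⇒m≤1+n x<k , px)
...   | no nq = no λ { (x , x<sk , px) → case x <? k of λ
                  { (yes x<k) → nq (x , x<k , px)
                  ; (no x≮k) → np (subst _ (≤-antisym (s≤s⁻¹ x<sk) (≮⇒≥ x≮k)) px) } }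

largest-witness : ∀ {P : ℕ → Set} → (∀ x → Dec (P x)) → ∀ k → ∀ x → x < k → P x →
                  ∃[ y ] (x ≤ y × y < k × P y × (∀ z → y < z → z < k → ¬ P z))
largest-witness P? zero x () px
largest-witness P? (suc k) x x<sk px with P? k
... | yes pk = k , s≤s⁻¹ x<sk , ≤-refl , pk , λ z y<z z<sk → ⊥-elim (<-irrefl refl (≤-trans z<sk y<z))
... | no npk with x <? k
...   | no x≮k = ⊥-elim (npk (subst _ (≤-antisym (s≤s⁻¹ x<sk) (≮⇒≥ x≮k)) px))
...   | yes x<k with largest-witness P? k x x<k px
...     | y , x≤y , y<k , py , mx = y , x≤y , m≤n⇒m≤1+n y<k , py , λ z y<z z<sk → case z <? k of λ
          { (yes z<k) → mx z y<z z<k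
          ; (no z≮k) → λ pz → npk (subst _ (≤-antisym (s≤s⁻¹ z<sk) (≮⇒≥ z≮k)) pz) }

least-witness : ∀ {P : ℕ → Set} → (∀ x → Dec (P x)) → ∀ x → P x →
                ∃[ y ] (y ≤ x × P y × (∀ z → z < y → ¬ P z))
least-witness {P} P? x px = descend x x ≤-refl px
  where
  descend : ∀ f x → x ≤ f → P x → ∃[ y ] (y ≤ x × P y × (∀ z → z < y → ¬ P z))
  descend f x x≤f px with search-below P? x
  ... | no nq = x , ≤-refl , px , λ z z<x pz → nq (z , z<x , pz)
  descend (suc f) x x≤f px | yes (z , z<x , pz) with descend f z (s≤s⁻¹ (≤-trans z<x x≤f)) pz
  ...   | y , y≤z , py , mn = y , ≤-trans y≤z (<⇒≤ z<x) , py , mn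
  descend zero x z≤n px | yes (z , () , pz)

-- The distances |x − y| compare a vertex, its parent and its
-- grandparent: below a white vertex y all labels lie between y and the
-- parent of y, below a black vertex between the parent and y.

dist-white-child : ∀ {x y z} → y < x → x < z → ∣ x - y ∣ < ∣ y - z ∣
dist-white-child {x} {y} {z} y<x x<z rewrite ∣-∣-comm x y | m≤n⇒∣m-n∣≡n∸m (<⇒≤ y<x) | m≤n⇒∣m-n∣≡n∸m (<⇒≤ (<-trans y<x x<z)) =
  ∸-monoˡ-< x<z (<⇒≤ y<x)

dist-black-child : ∀ {x y z} → z < x → x < y → ∣ x - y ∣ < ∣ y - z ∣
dist-black-child {x} {y} {z} z<x x<y rewrite ∣-∣-comm y z | m≤n⇒∣m-n∣≡n∸m (<⇒≤ x<y) | m≤n⇒∣m-n∣≡n∸m (<⇒≤ (<-trans z<x x<y)) =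
  ∸-monoʳ-< z<x (<⇒≤ x<y)

-- a white root x ∈ {1,…,n} hangs from n+1, which hangs from 0
dist-white-root : ∀ {x n} → 1 ≤ x → x ≤ n → ∣ x - suc n ∣ < ∣ suc n - 0 ∣
dist-white-root {suc x} {n} _ x≤n rewrite m≤n⇒∣m-n∣≡n∸m (m≤n⇒m≤1+n x≤n) = s≤s (m∸n≤m n x)

<m+1+n⇒≤m+n : ∀ {x} v j → x < v + suc j → x ≤ v + j
<m+1+n⇒≤m+n {x} v j lt = s≤s⁻¹ (subst (x <_) (+-suc v j) lt)

m<m+1+n : ∀ v j → v < v + suc j
m<m+1+n v j = m<m+n v (s≤s z≤n)

m+1+n<m+2+n : ∀ v j → v + suc j < v + suc (suc j)
m+1+n<m+2+n v j = +-monoʳ-< v (n<1+n (suc j))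

-- the parent n+1 of a white root i+1 is written (i+1) + suc k
suc-split : ∀ {n} i → suc i ≤ n → suc n ≡ suc i + suc (n ∸ suc i)
suc-split {n} i le = sym (trans (+-suc (suc i) (n ∸ suc i)) (cong suc (m+[n∸m]≡n le)))

+-∸-suc : ∀ u v → u < v → u + suc (v ∸ suc u) ≡ v
+-∸-suc u v u<v = trans (+-suc u (v ∸ suc u)) (m+[n∸m]≡n u<v)

-- An entry (p , s) is a subtree s of the forest
-- together with the label p of its parent; roots have the virtual parent
-- rootParent n s (n+1 for white roots, 0 for black ones).

Entry : Set
Entry = ℕ × PTree

mutual
  entries : ℕ → PTree → List Entry
  entries p (node c l ts) = (p , node c l ts) ∷ entriesF l ts
  entriesF : ℕ → List PTree → List Entry
  entriesF p [] = []
  entriesF p (t ∷ ts) = entries p t ++ entriesF p ts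

rootParent : ℕ → PTree → ℕ
rootParent n (node white _ _) = suc n
rootParent n (node black _ _) = 0

entriesR : ℕ → List PTree → List Entry
entriesR n [] = []
entriesR n (t ∷ ts) = entries (rootParent n t) t ++ entriesR n ts

label : Entry → ℕ
label e = root (proj₂ e)

-- the arc contributed by an entry: white vertices lie left of their parent
arcOf : Entry → Arc
arcOf (p , node white v _) = (v , p)
arcOf (p , node black v _) = (p , v)

kids : PTree → List PTree
kids (node _ _ ts) = ts

mutual
  labels-entries : ∀ p t → map label (entries p t) ≡ labels t
  labels-entries p (node c l ts) = cong (l ∷_) (labels-entriesF l ts)
  labels-entriesF : ∀ p ts → map label (entriesF p ts) ≡ labelsF ts
  labels-entriesF p [] = refl
  labels-entriesF p (t ∷ ts) = trans (map-++ label (entries p t) (entriesF p ts))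
                              (cong₂ _++_ (labels-entries p t) (labels-entriesF p ts))

labels-entriesR : ∀ n F → map label (entriesR n F) ≡ labelsF F
labels-entriesR n [] = refl
labels-entriesR n (t ∷ ts) = trans (map-++ label (entries (rootParent n t) t) (entriesR n ts))
                            (cong₂ _++_ (labels-entries (rootParent n t) t) (labels-entriesR n ts))

entry-of-label : ∀ {n F x} → x ∈ labelsF F → ∃[ e ] (e ∈ entriesR n F × label e ≡ x)
entry-of-label {n} {F} x∈ with ∈-map⁻ label (subst (_ ∈_) (sym (labels-entriesR n F)) x∈)
... | e , e∈ , eq = e , e∈ , sym eq

label-of-entry : ∀ {n F e} → e ∈ entriesR n F → label e ∈ labelsF F
label-of-entry {n} {F} e∈ = subst (_ ∈_) (labels-entriesR n F) (∈-map⁺ label e∈)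

mutual
  child-entry : ∀ {q t p s t'} → (p , s) ∈ entries q t → t' ∈ kids s → (root s , t') ∈ entries q t
  child-entry {q} {node c l ts} (here refl) t'∈ = there (child-entryTop t'∈)
  child-entry {q} {node c l ts} {p} {s} (there e∈) t'∈ = there (child-entryF {l} {ts} {p} {s} e∈ t'∈)
  child-entryTop : ∀ {l ts t'} → t' ∈ ts → (l , t') ∈ entriesF l ts
  child-entryTop {l} {t ∷ ts} {node _ _ _} (here refl) = ∈-++⁺ˡ {ys = entriesF l ts} (here refl)
  child-entryTop {l} {t ∷ ts} {t'} (there t'∈) = ∈-++⁺ʳ (entries l t) (child-entryTop {l} {ts} {t'} t'∈)
  child-entryF : ∀ {q ts p s t'} → (p , s) ∈ entriesF q ts → t' ∈ kids s → (root s , t') ∈ entriesF q ts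
  child-entryF {q} {t ∷ ts} {p} {s} e∈ t'∈ with ∈-++⁻ (entries q t) e∈
  ... | inj₁ x = ∈-++⁺ˡ (child-entry {q} {t} {p} {s} x t'∈)
  ... | inj₂ y = ∈-++⁺ʳ (entries q t) (child-entryF {q} {ts} {p} {s} y t'∈)

child-entryR : ∀ {n F p s t'} → (p , s) ∈ entriesR n F → t' ∈ kids s → (root s , t') ∈ entriesR n F
child-entryR {n} {t ∷ F} {p} {s} e∈ t'∈ with ∈-++⁻ (entries (rootParent n t) t) e∈
... | inj₁ x = ∈-++⁺ˡ (child-entry {rootParent n t} {t} {p} {s} x t'∈)
... | inj₂ y = ∈-++⁺ʳ (entries (rootParent n t) t) (child-entryR {n} {F} {p} {s} y t'∈)

ParentEntry : List Entry → ℕ → PTree → Set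
ParentEntry P p s = ∃[ q ] ∃[ c ] ∃[ ts ] ((q , node c p ts) ∈ P × s ∈ ts)

mutual
  parent-entry : ∀ {q t p s} → (p , s) ∈ entries q t → (p ≡ q × s ≡ t) ⊎ ParentEntry (entries q t) p s
  parent-entry {q} {node c l ts} (here refl) = inj₁ (refl , refl)
  parent-entry {q} {node c l ts} (there e∈) with parent-entryF {l} {ts} e∈
  ... | inj₁ (refl , s∈) = inj₂ (q , c , ts , here refl , s∈)
  ... | inj₂ (q' , c' , ts' , e'∈ , s∈) = inj₂ (q' , c' , ts' , there e'∈ , s∈)
  parent-entryF : ∀ {q ts p s} → (p , s) ∈ entriesF q ts → (p ≡ q × s ∈ ts) ⊎ ParentEntry (entriesF q ts) p s
  parent-entryF {q} {t ∷ ts} e∈ with ∈-++⁻ (entries q t) e∈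
  ... | inj₂ y with parent-entryF y
  ...   | inj₁ (eq , s∈) = inj₁ (eq , there s∈)
  ...   | inj₂ (q' , c' , ts' , e'∈ , s∈) = inj₂ (q' , c' , ts' , ∈-++⁺ʳ (entries q t) e'∈ , s∈)
  parent-entryF {q} {t ∷ ts} e∈ | inj₁ x with parent-entry x
  ...   | inj₁ (eq , refl) = inj₁ (eq , here refl)
  ...   | inj₂ (q' , c' , ts' , e'∈ , s∈) = inj₂ (q' , c' , ts' , ∈-++⁺ˡ e'∈ , s∈)

parent-entryR : ∀ {n F p s} → (p , s) ∈ entriesR n F → (p ≡ rootParent n s × s ∈ F) ⊎ ParentEntry (entriesR n F) p s
parent-entryR {n} {t ∷ F} e∈ with ∈-++⁻ (entries (rootParent n t) t) e∈
... | inj₁ x with parent-entry x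
...   | inj₁ (refl , refl) = inj₁ (refl , here refl)
...   | inj₂ (q' , c' , ts' , e'∈ , s∈) = inj₂ (q' , c' , ts' , ∈-++⁺ˡ e'∈ , s∈)
parent-entryR {n} {t ∷ F} e∈ | inj₂ y with parent-entryR y
...   | inj₁ (eq , s∈) = inj₁ (eq , there s∈)
...   | inj₂ (q' , c' , ts' , e'∈ , s∈) = inj₂ (q' , c' , ts' , ∈-++⁺ʳ (entries (rootParent n t) t) e'∈ , s∈)

root-entry : ∀ {n F t} → t ∈ F → (rootParent n t , t) ∈ entriesR n F
root-entry {n} {t ∷ F} {node _ _ _} (here refl) = ∈-++⁺ˡ {ys = entriesR n F} (here refl)
root-entry {n} {t ∷ F} {t'} (there t∈) = ∈-++⁺ʳ (entries (rootParent n t) t) (root-entry {n} {F} {t'} t∈)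

entriesR-split : ∀ {n} G {e} → e ∈ entriesR n G → ∃[ t ] (t ∈ G × e ∈ entries (rootParent n t) t)
entriesR-split {n} (t ∷ G) e∈ with ∈-++⁻ (entries (rootParent n t) t) e∈
... | inj₁ x = t , here refl , x
... | inj₂ y with entriesR-split G y
...   | t' , t'∈ , z = t' , there t'∈ , z

entriesR-sub : ∀ {n} G {t e} → t ∈ G → e ∈ entries (rootParent n t) t → e ∈ entriesR n G
entriesR-sub {n} (t ∷ G) (here refl) e∈ = ∈-++⁺ˡ e∈
entriesR-sub {n} (t' ∷ G) (there t∈) e∈ = ∈-++⁺ʳ (entries (rootParent n t') t') (entriesR-sub G t∈ e∈)

labels-subtree : ∀ {t ts x} → t ∈ ts → x ∈ labels t → x ∈ labelsF ts
labels-subtree {t} {t ∷ ts} (here refl) x∈ = ∈-++⁺ˡ x∈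
labels-subtree {t} {t' ∷ ts} (there t∈) x∈ = ∈-++⁺ʳ (labels t') (labels-subtree t∈ x∈)

root∈labels : ∀ t → root t ∈ labels t
root∈labels (node _ _ _) = here refl

root∈labelsF : ∀ {t ts} → t ∈ ts → root t ∈ labelsF ts
root∈labelsF {t} t∈ = labels-subtree t∈ (root∈labels t)

tree-of-label : ∀ {ts x} → x ∈ labelsF ts → ∃[ t ] (t ∈ ts × x ∈ labels t)
tree-of-label {t ∷ ts} x∈ with ∈-++⁻ (labels t) x∈
... | inj₁ a = t , here refl , a
... | inj₂ b with tree-of-label b
...   | t' , t'∈ , c = t' , there t'∈ , c

All-labelsF : ∀ {P : ℕ → Set} ts → All (λ t → All P (labels t)) ts → All P (labelsF ts)
All-labelsF [] [] = []
All-labelsF (t ∷ ts) (a ∷ as) = AP.++⁺ a (All-labelsF ts as)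

unique-labels⇒unique-trees : ∀ F → Unique (labelsF F) → Unique F
unique-labels⇒unique-trees [] _ = []
unique-labels⇒unique-trees (t ∷ F) u with unique-++⁻ (labels t) u
... | _ , u2 = All.tabulate (λ t'∈ e → unique-++⇒disjoint (labels t) u (root∈labels t) (subst (λ z → root z ∈ labelsF F) (sym e) (root∈labelsF t'∈))) ∷ unique-labels⇒unique-trees F u2

Bounded : Entry → Set
Bounded (p , node white l ts) = All (_< p) (l ∷ labelsF ts)
Bounded (p , node black l ts) = All (p <_) (l ∷ labelsF ts)

All-subtree : ∀ {P : ℕ → Set} {t ts} → t ∈ ts → All P (labelsF ts) → All P (labels t)
All-subtree t∈ a = All.tabulate (λ x∈ → All.lookup a (labels-subtree t∈ x∈))

child-alt : ∀ {c l ts t} → AltTree (node c l ts) → t ∈ ts → AltTree t × Bounded (l , t)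
child-alt {t = node c' l' ts'} (white-node mn col lk al) t∈ with All.lookup col t∈
... | refl = All.lookup al t∈ , All-subtree t∈ mn
child-alt {t = node c' l' ts'} (black-node mx col lk al) t∈ with All.lookup col t∈
... | refl = All.lookup al t∈ , All-subtree t∈ mx

head-entry : ∀ l t → (l , t) ∈ entries l t
head-entry l (node c x ts) = here refl

entries-split : ∀ {l t e} → e ∈ entries l t → e ≡ (l , t) ⊎ e ∈ entriesF (root t) (kids t)
entries-split {l} {node c r ts} (here refl) = inj₁ refl
entries-split {l} {node c r ts} (there e∈) = inj₂ e∈

entries⊆entriesF : ∀ {l t ts e} → t ∈ ts → e ∈ entries l t → e ∈ entriesF l ts
entries⊆entriesF {l} {t} {t ∷ ts} (here refl) e∈ = ∈-++⁺ˡ e∈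
entries⊆entriesF {l} {t} {t' ∷ ts} (there t∈) e∈ = ∈-++⁺ʳ (entries l t') (entries⊆entriesF t∈ e∈)

entriesF⊆entries : ∀ {l t e} → e ∈ entriesF (root t) (kids t) → e ∈ entries l t
entriesF⊆entries {l} {node c r ts} e∈ = there e∈

mutual
  entry-alt : ∀ q t → AltTree t → Bounded (q , t) → ∀ {e} → e ∈ entries q t → AltTree (proj₂ e) × Bounded e
  entry-alt q (node c l ts) alt b (here refl) = alt , b
  entry-alt q (node c l ts) alt b (there e∈) = entryF-alt l ts (λ t∈ → child-alt alt t∈) e∈
  entryF-alt : ∀ l ts → (∀ {t} → t ∈ ts → AltTree t × Bounded (l , t)) → ∀ {e} → e ∈ entriesF l ts → AltTree (proj₂ e) × Bounded e
  entryF-alt l (t ∷ ts) h e∈ with ∈-++⁻ (entries l t) e∈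
  ... | inj₁ x = entry-alt l t (proj₁ (h (here refl))) (proj₂ (h (here refl))) x
  ... | inj₂ y = entryF-alt l ts (λ t∈ → h (there t∈)) y

label-range : ∀ {n F x} → AltForest n F → x ∈ labelsF F → 1 ≤ x × x ≤ n
label-range {n} (_ , perm) x∈ with ∈-map⁻ suc (∈-resp-↭ perm x∈)
... | i , i∈ , refl = s≤s z≤n , ∈-upTo⁻ i∈

unique-labels : ∀ {n F} → AltForest n F → Unique (labelsF F)
unique-labels {n} (_ , perm) = Unique-resp-↭ (↭-sym perm) (UP.map⁺ suc-injective (UP.upTo⁺ n))

root-bounded : ∀ {n F t} → AltForest n F → t ∈ F → Bounded (rootParent n t , t)
root-bounded {n} {F} {node white l ts} af t∈ =
  All.tabulate (λ x∈ → s≤s (proj₂ (label-range af (labels-subtree t∈ x∈))))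
root-bounded {n} {F} {node black l ts} af t∈ =
  All.tabulate (λ x∈ → proj₁ (label-range af (labels-subtree t∈ x∈)))

entryR-alt : ∀ {n F} → AltForest n F → ∀ {e} → e ∈ entriesR n F → AltTree (proj₂ e) × Bounded e
entryR-alt {n} {F} af = over-trees F (λ t∈ → All.lookup (proj₁ af) t∈ , root-bounded af t∈)
  where
  over-trees : ∀ G → (∀ {t} → t ∈ G → AltTree t × Bounded (rootParent n t , t)) → ∀ {e} → e ∈ entriesR n G → AltTree (proj₂ e) × Bounded e
  over-trees (t ∷ G) h e∈ with ∈-++⁻ (entries (rootParent n t) t) e∈
  ... | inj₁ x = entry-alt (rootParent n t) t (proj₁ (h (here refl))) (proj₂ (h (here refl))) x
  ... | inj₂ y = over-trees G (λ t∈ → h (there t∈)) y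

-- Apart from (0 , n+1), the arcs of φ F are exactly the
-- arcs of the entries of F: the edge (min , max) between a vertex and a
-- child is the child's entry arc, and the root arcs are the roots' entry arcs.

edgeOf : ℕ → PTree → Arc
edgeOf l t = (l ⊓ root t , l ⊔ root t)

edge≡arcOf : ∀ {c l ts t} → AltTree (node c l ts) → t ∈ ts → edgeOf l t ≡ arcOf (l , t)
edge≡arcOf {t = node c' r ts'} (white-node mn col lk al) t∈ with All.lookup col t∈
... | refl = let l<r = All.lookup mn (root∈labelsF t∈) in
  cong₂ _,_ (m≤n⇒m⊓n≡m (<⇒≤ l<r)) (m≤n⇒m⊔n≡n (<⇒≤ l<r))
edge≡arcOf {t = node c' r ts'} (black-node mx col lk al) t∈ with All.lookup col t∈
... | refl = let r<l = All.lookup mx (root∈labelsF t∈) in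
  cong₂ _,_ (m≥n⇒m⊓n≡n (<⇒≤ r<l)) (m≥n⇒m⊔n≡m (<⇒≤ r<l))

alt-kids : ∀ {t} → AltTree t → All AltTree (kids t)
alt-kids (white-node _ _ _ al) = al
alt-kids (black-node _ _ _ al) = al

mutual
  edge⇒ : ∀ t → AltTree t → ∀ {a} → a ∈ edges t → ∃[ e ] (e ∈ entriesF (root t) (kids t) × arcOf e ≡ a)
  edge⇒ (node c l ts) alt a∈ with ∈-++⁻ (map (edgeOf l) ts) a∈
  ... | inj₁ x with ∈-map⁻ (edgeOf l) x
  ...   | t , t∈ , refl = (l , t) , child-entryTop t∈ , sym (edge≡arcOf alt t∈)
  edge⇒ (node c l ts) alt a∈ | inj₂ y with edgeF⇒ ts (alt-kids alt) y
  ...   | t , t∈ , e , e∈ , eq = e , entries⊆entriesF t∈ (entriesF⊆entries {l} {t} e∈) , eq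
  edgeF⇒ : ∀ ts → All AltTree ts → ∀ {a} → a ∈ edgesF ts →
           ∃[ t ] (t ∈ ts × ∃[ e ] (e ∈ entriesF (root t) (kids t) × arcOf e ≡ a))
  edgeF⇒ (t ∷ ts) (at ∷ ats) a∈ with ∈-++⁻ (edges t) a∈
  ... | inj₁ x with edge⇒ t at x
  ...   | e , e∈ , eq = t , here refl , e , e∈ , eq
  edgeF⇒ (t ∷ ts) (at ∷ ats) a∈ | inj₂ y with edgeF⇒ ts ats y
  ...   | t' , t'∈ , r = t' , there t'∈ , r


mutual
  edge⇐ : ∀ t → AltTree t → ∀ {e} → e ∈ entriesF (root t) (kids t) → arcOf e ∈ edges t
  edge⇐ (node c l ts) alt e∈ = edgeF⇐ l ts (alt-kids alt) (edge≡arcOf alt) e∈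
  edgeF⇐ : ∀ l ts → All AltTree ts → (∀ {t} → t ∈ ts → edgeOf l t ≡ arcOf (l , t)) →
           ∀ {e} → e ∈ entriesF l ts → arcOf e ∈ map (edgeOf l) ts ++ edgesF ts
  edgeF⇐ l (t ∷ ts) (at ∷ ats) eqs e∈ with ∈-++⁻ (entries l t) e∈
  ... | inj₁ x with entries-split {l} {t} x
  ...   | inj₁ refl = here (sym (eqs (here refl)))
  ...   | inj₂ z = there (∈-++⁺ʳ (map (edgeOf l) ts) (∈-++⁺ˡ (edge⇐ t at z)))
  edgeF⇐ l (t ∷ ts) (at ∷ ats) eqs e∈ | inj₂ y with ∈-++⁻ (map (edgeOf l) ts) (edgeF⇐ l ts ats (λ t∈ → eqs (there t∈)) y)
  ...   | inj₁ a = there (∈-++⁺ˡ a)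
  ...   | inj₂ b = there (∈-++⁺ʳ (map (edgeOf l) ts) (∈-++⁺ʳ (edges t) b))

nonTopArcs : ℕ → List PTree → List Arc
nonTopArcs n F = rootArcs n F ++ edgesF F

nonTopArcs-∷⁻ : ∀ n t F {a} → a ∈ nonTopArcs n (t ∷ F) → a ≡ arcOf (rootParent n t , t) ⊎ (a ∈ edges t ⊎ a ∈ nonTopArcs n F)
nonTopArcs-∷⁻ n (node white w ts) F (here refl) = inj₁ refl
nonTopArcs-∷⁻ n (node black w ts) F (here refl) = inj₁ refl
nonTopArcs-∷⁻ n (node white w ts) F (there a∈) with ∈-++⁻ (rootArcs n F) a∈
... | inj₁ x = inj₂ (inj₂ (∈-++⁺ˡ x))
... | inj₂ y with ∈-++⁻ (edges (node white w ts)) y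
...   | inj₁ z = inj₂ (inj₁ z)
...   | inj₂ z = inj₂ (inj₂ (∈-++⁺ʳ (rootArcs n F) z))
nonTopArcs-∷⁻ n (node black w ts) F (there a∈) with ∈-++⁻ (rootArcs n F) a∈
... | inj₁ x = inj₂ (inj₂ (∈-++⁺ˡ x))
... | inj₂ y with ∈-++⁻ (edges (node black w ts)) y
...   | inj₁ z = inj₂ (inj₁ z)
...   | inj₂ z = inj₂ (inj₂ (∈-++⁺ʳ (rootArcs n F) z))

nonTopArcs-∷⁺root : ∀ n t F → arcOf (rootParent n t , t) ∈ nonTopArcs n (t ∷ F)
nonTopArcs-∷⁺root n (node white w ts) F = here refl
nonTopArcs-∷⁺root n (node black w ts) F = here refl

nonTopArcs-∷⁺edge : ∀ n t F {a} → a ∈ edges t → a ∈ nonTopArcs n (t ∷ F)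
nonTopArcs-∷⁺edge n (node white w ts) F a∈ = there (∈-++⁺ʳ (rootArcs n F) (∈-++⁺ˡ a∈))
nonTopArcs-∷⁺edge n (node black w ts) F a∈ = there (∈-++⁺ʳ (rootArcs n F) (∈-++⁺ˡ a∈))

nonTopArcs-∷⁺rest : ∀ n t F {a} → a ∈ nonTopArcs n F → a ∈ nonTopArcs n (t ∷ F)
nonTopArcs-∷⁺rest n t F a∈ with ∈-++⁻ (rootArcs n F) a∈
nonTopArcs-∷⁺rest n (node white w ts) F a∈ | inj₁ x = there (∈-++⁺ˡ x)
nonTopArcs-∷⁺rest n (node black w ts) F a∈ | inj₁ x = there (∈-++⁺ˡ x)
nonTopArcs-∷⁺rest n (node white w ts) F a∈ | inj₂ y = there (∈-++⁺ʳ (rootArcs n F) (∈-++⁺ʳ (edges (node white w ts)) y))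
nonTopArcs-∷⁺rest n (node black w ts) F a∈ | inj₂ y = there (∈-++⁺ʳ (rootArcs n F) (∈-++⁺ʳ (edges (node black w ts)) y))

nonTopArcs⇒entry : ∀ n F → All AltTree F → ∀ {a} → a ∈ nonTopArcs n F → ∃[ e ] (e ∈ entriesR n F × arcOf e ≡ a)
nonTopArcs⇒entry n (t ∷ F) (at ∷ ats) a∈ with nonTopArcs-∷⁻ n t F a∈
... | inj₁ refl = (rootParent n t , t) , root-entry {n} {t ∷ F} (here refl) , refl
... | inj₂ (inj₁ x) with edge⇒ t at x
...   | e , e∈ , eq = e , ∈-++⁺ˡ (entriesF⊆entries {rootParent n t} {t} e∈) , eq
nonTopArcs⇒entry n (t ∷ F) (at ∷ ats) a∈ | inj₂ (inj₂ y) with nonTopArcs⇒entry n F ats y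
...   | e , e∈ , eq = e , ∈-++⁺ʳ (entries (rootParent n t) t) e∈ , eq

entry⇒nonTopArc : ∀ n F → All AltTree F → ∀ {e} → e ∈ entriesR n F → arcOf e ∈ nonTopArcs n F
entry⇒nonTopArc n (t ∷ F) (at ∷ ats) e∈ with ∈-++⁻ (entries (rootParent n t) t) {entriesR n F} e∈
... | inj₂ y = nonTopArcs-∷⁺rest n t F (entry⇒nonTopArc n F ats y)
... | inj₁ x with entries-split {rootParent n t} {t} x
...   | inj₁ refl = nonTopArcs-∷⁺root n t F
...   | inj₂ z = nonTopArcs-∷⁺edge n t F (edge⇐ t at z)

φ-arc⇒entry : ∀ n F → All AltTree F → ∀ {a} → a ∈ φ n F → a ≡ (0 , suc n) ⊎ ∃[ e ] (e ∈ entriesR n F × arcOf e ≡ a)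
φ-arc⇒entry n F al (here refl) = inj₁ refl
φ-arc⇒entry n F al (there a∈) = inj₂ (nonTopArcs⇒entry n F al a∈)

entry⇒φ-arc : ∀ n F → All AltTree F → ∀ {e} → e ∈ entriesR n F → arcOf e ∈ φ n F
entry⇒φ-arc n F al e∈ = there (entry⇒nonTopArc n F al e∈)

data NonBacktracking : List ℕ → Set where
  nbt-[] : NonBacktracking []
  nbt-[x] : ∀ {x} → NonBacktracking (x ∷ [])
  nbt-[x,y] : ∀ {x y} → NonBacktracking (x ∷ y ∷ [])
  nbt-∷ : ∀ {x y z zs} → x ≢ z → NonBacktracking (y ∷ z ∷ zs) → NonBacktracking (x ∷ y ∷ z ∷ zs)

unique⇒nonBacktracking : ∀ {L} → Unique L → NonBacktracking L
unique⇒nonBacktracking {[]} _ = nbt-[]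
unique⇒nonBacktracking {x ∷ []} _ = nbt-[x]
unique⇒nonBacktracking {x ∷ y ∷ []} _ = nbt-[x,y]
unique⇒nonBacktracking {x ∷ y ∷ z ∷ zs} ((_ ∷ x≢z ∷ _) ∷ u) = nbt-∷ x≢z (unique⇒nonBacktracking u)

-- Traversing a cycle one and a half times, v c … w v c, stays
-- non-backtracking.
nonBacktracking-extend : ∀ {a b} x y zs → zs ≢ [] → NonBacktracking (x ∷ y ∷ zs) → All (_≢ a) (y ∷ zs) → All (_≢ b) zs →
        NonBacktracking (x ∷ y ∷ zs ++ a ∷ b ∷ [])
nonBacktracking-extend x y [] ne _ _ _ = ⊥-elim (ne refl)
nonBacktracking-extend x y (z ∷ []) ne (nbt-∷ x≢z _) (y≢a ∷ _) (z≢b ∷ _) = nbt-∷ x≢z (nbt-∷ y≢a (nbt-∷ z≢b nbt-[x,y]))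
nonBacktracking-extend x y (z ∷ z' ∷ zs) ne (nbt-∷ x≢z nb) (_ ∷ ha) (_ ∷ hb) =
  nbt-∷ x≢z (nonBacktracking-extend y z (z' ∷ zs) (λ ()) nb ha hb)

linked-extend : ∀ {R : ℕ → ℕ → Set} {w a b} xs → Linked R (xs ++ w ∷ []) → R w a → R a b →
          Linked R (xs ++ w ∷ a ∷ b ∷ [])
linked-extend [] l r1 r2 = r1 ∷ r2 ∷ [-]
linked-extend (x ∷ []) (r ∷ l) r1 r2 = r ∷ linked-extend [] l r1 r2
linked-extend (x ∷ y ∷ xs) (r ∷ l) r1 r2 = r ∷ linked-extend (y ∷ xs) l r1 r2

-- Along a non-backtracking walk the steps cannot switch from
-- "down" to "up", so a closed walk would be monotone and μ would exceed
-- itself.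
module ParentAcyclic (A : List Arc) (Parent : ℕ → ℕ → Set) (μ : ℕ → ℕ → ℕ)
  (adj-parent : ∀ {u v} → Adj A u v → Parent u v ⊎ Parent v u)
  (parent-functional : ∀ {x y y'} → Parent x y → Parent x y' → y ≡ y')
  (parent-dist-grows : ∀ {x y z} → Parent x y → Parent y z → μ x y < μ y z) where

  Child : ℕ → ℕ → Set
  Child x y = Parent y x

  descending-walk : ∀ {a b} xs → Linked (Adj A) (a ∷ b ∷ xs) → NonBacktracking (a ∷ b ∷ xs) → Parent b a → Linked Child (a ∷ b ∷ xs)
  descending-walk [] l nb p = p ∷ [-]
  descending-walk (c ∷ xs) (_ ∷ l@(adj ∷ _)) (nbt-∷ a≢c nb) p with adj-parent adj
  ... | inj₁ pbc = ⊥-elim (a≢c (parent-functional p pbc))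
  ... | inj₂ pcb = p ∷ descending-walk xs l nb pcb

  LastStepUp : List ℕ → Set
  LastStepUp [] = ⊥
  LastStepUp (x ∷ []) = ⊥
  LastStepUp (x ∷ y ∷ []) = Parent x y
  LastStepUp (x ∷ y ∷ z ∷ zs) = LastStepUp (y ∷ z ∷ zs)

  ascending-walk : ∀ {a b} xs → Linked (Adj A) (a ∷ b ∷ xs) → NonBacktracking (a ∷ b ∷ xs) → LastStepUp (a ∷ b ∷ xs) → Linked Parent (a ∷ b ∷ xs)
  ascending-walk [] l nb p = p ∷ [-]
  ascending-walk (c ∷ xs) (adj ∷ l) (nbt-∷ a≢c nb) lu with ascending-walk xs l nb lu
  ... | lk@(pbc ∷ _) with adj-parent adj
  ...   | inj₁ pab = pab ∷ lk
  ...   | inj₂ pba = ⊥-elim (a≢c (parent-functional pba pbc))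

  lastStepUp : ∀ x y xs w u v → Parent u v → LastStepUp (x ∷ y ∷ xs ++ w ∷ u ∷ v ∷ [])
  lastStepUp x y [] w u v p = p
  lastStepUp x y (z ∷ xs) w u v p = lastStepUp y z xs w u v p

  μ-ascending : ∀ x y xs w u v → Linked Parent (x ∷ y ∷ xs ++ w ∷ u ∷ v ∷ []) → μ x y < μ u v
  μ-ascending x y [] w u v (p1 ∷ p2 ∷ p3 ∷ p4 ∷ [-]) = <-trans (parent-dist-grows p1 p2) (<-trans (parent-dist-grows p2 p3) (parent-dist-grows p3 p4))
  μ-ascending x y (z ∷ xs) w u v (p1 ∷ l@(p2 ∷ _)) = <-trans (parent-dist-grows p1 p2) (μ-ascending y z xs w u v l)

  μ-descending : ∀ x y xs w u v → Linked Child (x ∷ y ∷ xs ++ w ∷ u ∷ v ∷ []) → μ v u < μ y x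
  μ-descending x y [] w u v (p1 ∷ p2 ∷ p3 ∷ p4 ∷ [-]) = <-trans (parent-dist-grows p4 p3) (<-trans (parent-dist-grows p3 p2) (parent-dist-grows p2 p1))
  μ-descending x y (z ∷ xs) w u v (p1 ∷ l@(p2 ∷ _)) = <-trans (μ-descending y z xs w u v l) (parent-dist-grows p2 p1)

  -- Walking once around the cycle and on through its first two points,
  -- v c₁ … w v c₁, gives a non-backtracking walk whose first and last
  -- steps coincide.  If that step goes up, the walk is ascending, if it
  -- goes down it is descending; either way μ of the step exceeds itself.
  noCycle : ¬ Cycle A
  noCycle (cycle v [] w () u lk close)
  noCycle (cycle v (c₁ ∷ vs) w _ u lk close) = contradiction
    where
    first : Adj A v c₁
    first = Linked.head lk
    walk : Linked (Adj A) (v ∷ c₁ ∷ vs ++ w ∷ v ∷ c₁ ∷ [])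
    walk = linked-extend (v ∷ c₁ ∷ vs) lk close first
    v-fresh : All (_≢ v) (c₁ ∷ vs ++ w ∷ [])
    v-fresh = All.map (λ ne e → ne (sym e)) (AllPairs.head u)
    c₁-fresh : All (_≢ c₁) (vs ++ w ∷ [])
    c₁-fresh = All.map (λ ne e → ne (sym e)) (AllPairs.head (AllPairs.tail u))
    nonEmpty : ∀ xs → xs ++ w ∷ [] ≢ []
    nonEmpty [] ()
    nonEmpty (_ ∷ _) ()
    nonBacktracking : NonBacktracking (v ∷ c₁ ∷ vs ++ w ∷ v ∷ c₁ ∷ [])
    nonBacktracking = subst NonBacktracking (cong (λ t → v ∷ c₁ ∷ t) (++-assoc vs (w ∷ []) (v ∷ c₁ ∷ [])))
      (nonBacktracking-extend v c₁ (vs ++ w ∷ []) (nonEmpty vs) (unique⇒nonBacktracking u) v-fresh c₁-fresh)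
    contradiction : ⊥
    contradiction with adj-parent first
    ... | inj₁ up = <-irrefl refl (μ-ascending v c₁ vs w v c₁
                      (ascending-walk (vs ++ w ∷ v ∷ c₁ ∷ []) walk nonBacktracking (lastStepUp v c₁ vs w v c₁ up)))
    ... | inj₂ dn = <-irrefl refl (μ-descending v c₁ vs w v c₁
                      (descending-walk (vs ++ w ∷ v ∷ c₁ ∷ []) walk nonBacktracking dn))

opp : Color → Color
opp white = black
opp black = white

parent-colour : ∀ {c p ts s} → AltTree (node c p ts) → s ∈ ts → c ≡ opp (color s)
parent-colour {s = node _ _ _} (white-node _ col _ _) s∈ with All.lookup col s∈
... | refl = refl
parent-colour {s = node _ _ _} (black-node _ col _ _) s∈ with All.lookup col s∈
... | refl = refl

module ForestToDiagram (n : ℕ) (F : List PTree) (af : AltForest n F) where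

  A : List Arc
  A = φ n F

  P : List Entry
  P = entriesR n F

  alF : All AltTree F
  alF = proj₁ af

  entry-ok : ∀ {e} → e ∈ P → AltTree (proj₂ e) × Bounded e
  entry-ok = entryR-alt af

  entry-injective : ∀ {e e'} → e ∈ P → e' ∈ P → label e ≡ label e' → e ≡ e'
  entry-injective = unique⇒map-injective label (subst Unique (sym (labels-entriesR n F)) (unique-labels af))

  entry-range : ∀ {e} → e ∈ P → 1 ≤ label e × label e ≤ n
  entry-range e∈ = label-range af (label-of-entry {n} {F} e∈)

  arc∈φ : ∀ {e} → e ∈ P → arcOf e ∈ A
  arc∈φ = entry⇒φ-arc n F alF

  parent-info : ∀ {p s} → (p , s) ∈ P → p ≡ rootParent n s ⊎ ∃[ q ] ∃[ ts ] ((q , node (opp (color s)) p ts) ∈ P × s ∈ ts)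
  parent-info e∈ with parent-entryR {n} {F} e∈
  ... | inj₁ (eq , _) = inj₁ eq
  ... | inj₂ (q , c , ts , e'∈ , s∈) with parent-colour (proj₁ (entry-ok e'∈)) s∈
  ...   | refl = inj₂ (q , ts , e'∈ , s∈)

  -- Labels are unique, so two entries with the same label share their children.
  same-label⇒kid : ∀ {p s q ts c} → (p , s) ∈ P → (q , node c (root s) ts) ∈ P → ∀ {t} → t ∈ ts → t ∈ kids s
  same-label⇒kid {p} {node c' r ts'} e∈ e'∈ t∈ with entry-injective e∈ e'∈ refl
  ... | refl = t∈

  arcDiag : ArcDiagram n A
  arcDiag = All.tabulate bounds
    where
    bounds : ∀ {a} → a ∈ A → proj₁ a < proj₂ a × proj₂ a ≤ suc n
    bounds a∈ with φ-arc⇒entry n F alF a∈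
    ... | inj₁ refl = s≤s z≤n , ≤-refl
    ... | inj₂ ((p , node white v ts) , e∈ , refl) with entry-ok e∈ | parent-info e∈
    ...   | _ , (v<p ∷ _) | inj₁ refl = v<p , ≤-refl
    ...   | _ , (v<p ∷ _) | inj₂ (q , ts' , e'∈ , _) = v<p , m≤n⇒m≤1+n (proj₂ (entry-range e'∈))
    bounds a∈ | inj₂ ((p , node black v ts) , e∈ , refl) with entry-ok e∈
    ...   | _ , (p<v ∷ _) = p<v , m≤n⇒m≤1+n (proj₂ (entry-range e∈))

  BlackAt WhiteAt : ℕ → Set
  BlackAt i = ∃[ q ] ∃[ ts ] ((q , node black i ts) ∈ P)
  WhiteAt i = ∃[ q ] ∃[ ts ] ((q , node white i ts) ∈ P)

  -- Condition (1): a right endpoint is n+1 or a black vertex, a left endpoint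
  -- 0 or a white vertex, and no label is both.
  rightEnd-shape : ∀ {k i} → (k , i) ∈ A → i ≡ suc n ⊎ BlackAt i
  rightEnd-shape a∈ with φ-arc⇒entry n F alF a∈
  ... | inj₁ refl = inj₁ refl
  ... | inj₂ ((p , node white v ts) , e∈ , refl) with parent-info e∈
  ...   | inj₁ refl = inj₁ refl
  ...   | inj₂ (q , ts' , e'∈ , _) = inj₂ (q , ts' , e'∈)
  rightEnd-shape a∈ | inj₂ ((p , node black v ts) , e∈ , refl) = inj₂ (p , ts , e∈)

  leftEnd-shape : ∀ {i j} → (i , j) ∈ A → i ≡ 0 ⊎ WhiteAt i
  leftEnd-shape a∈ with φ-arc⇒entry n F alF a∈
  ... | inj₁ refl = inj₁ refl
  ... | inj₂ ((p , node white v ts) , e∈ , refl) = inj₂ (p , ts , e∈)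
  ... | inj₂ ((p , node black v ts) , e∈ , refl) with parent-info e∈
  ...   | inj₁ refl = inj₁ refl
  ...   | inj₂ (q , ts' , e'∈ , _) = inj₂ (q , ts' , e'∈)

  cond1 : ∀ k i j → (k , i) ∈ A → (i , j) ∈ A → ⊥
  cond1 k i j a1 a2 with rightEnd-shape a1 | leftEnd-shape a2
  ... | inj₁ refl | inj₁ ()
  ... | inj₁ refl | inj₂ (q , ts , e∈) = <-irrefl refl (proj₂ (entry-range e∈))
  ... | inj₂ (q , ts , e∈) | inj₁ refl with entry-range e∈
  ...   | () , _
  cond1 k i j a1 a2 | inj₂ (q , ts , e∈) | inj₂ (q' , ts' , e'∈) with entry-injective e∈ e'∈ refl
  ... | ()

  entry-adj : ∀ {e} → e ∈ P → Adj A (proj₁ e) (label e)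
  entry-adj {p , node white v ts} e∈ = inj₂ (arc∈φ e∈)
  entry-adj {p , node black v ts} e∈ = inj₁ (arc∈φ e∈)

  mutual
    reach-entries : ∀ q t → (∀ {e} → e ∈ entries q t → e ∈ P) → Reach A 0 q → ∀ {e} → e ∈ entries q t → Reach A 0 (label e)
    reach-entries q (node c l ts) sub r (here refl) = step r (entry-adj (sub (here refl)))
    reach-entries q (node c l ts) sub r (there e∈) =
      reach-entriesF l ts (λ x → sub (there x)) (step r (entry-adj (sub (here refl)))) e∈
    reach-entriesF : ∀ l ts → (∀ {e} → e ∈ entriesF l ts → e ∈ P) → Reach A 0 l → ∀ {e} → e ∈ entriesF l ts → Reach A 0 (label e)
    reach-entriesF l (t ∷ ts) sub r e∈ with ∈-++⁻ (entries l t) e∈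
    ... | inj₁ x = reach-entries l t (λ y → sub (∈-++⁺ˡ y)) r x
    ... | inj₂ y = reach-entriesF l ts (λ z → sub (∈-++⁺ʳ (entries l t) z)) r y

  reach-entriesR : ∀ G → (∀ {e} → e ∈ entriesR n G → e ∈ P) → ∀ {e} → e ∈ entriesR n G → Reach A 0 (label e)
  reach-entriesR (t ∷ G) sub e∈ with ∈-++⁻ (entries (rootParent n t) t) e∈
  ... | inj₂ y = reach-entriesR G (λ z → sub (∈-++⁺ʳ (entries (rootParent n t) t) z)) y
  ... | inj₁ x = reach-entries (rootParent n t) t (λ y → sub (∈-++⁺ˡ y)) (r0 t) x
    where
    r0 : ∀ t → Reach A 0 (rootParent n t)
    r0 (node white _ _) = step here (inj₁ (here refl))
    r0 (node black _ _) = here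

  reach-from-0 : ∀ x → x ≤ suc n → Reach A 0 x
  reach-from-0 zero _ = here
  reach-from-0 (suc x) sx≤ with suc x ≟ suc n
  ... | yes refl = step here (inj₁ (here refl))
  ... | no ne with entry-of-label {n} {F} (∈-resp-↭ (↭-sym (proj₂ af)) (∈-map⁺ suc (∈-upTo⁺ (s<s⁻¹ (≤∧≢⇒< sx≤ ne)))))
  ...   | e , e∈ , eq = subst (Reach A 0) eq (reach-entriesR F (λ z → z) e∈)

  -- Acyclicity via ParentAcyclic with the parent relation of the forest
  -- (n+1 hangs from 0) and μ = distance.
  Parent : ℕ → ℕ → Set
  Parent x y = (x ≡ suc n × y ≡ 0) ⊎ ∃[ s ] ((y , s) ∈ P × root s ≡ x)

  arc-parent : ∀ {a b} → (a , b) ∈ A → Parent a b ⊎ Parent b a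
  arc-parent a∈ with φ-arc⇒entry n F alF a∈
  ... | inj₁ refl = inj₂ (inj₁ (refl , refl))
  ... | inj₂ ((p , node white v ts) , e∈ , refl) = inj₁ (inj₂ (_ , e∈ , refl))
  ... | inj₂ ((p , node black v ts) , e∈ , refl) = inj₂ (inj₂ (_ , e∈ , refl))

  adj-parent : ∀ {u v} → Adj A u v → Parent u v ⊎ Parent v u
  adj-parent (inj₁ x) = arc-parent x
  adj-parent (inj₂ y) with arc-parent y
  ... | inj₁ a = inj₂ a
  ... | inj₂ b = inj₁ b

  parent-functional : ∀ {x y y'} → Parent x y → Parent x y' → y ≡ y'
  parent-functional (inj₁ (_ , refl)) (inj₁ (_ , refl)) = refl
  parent-functional (inj₁ (eq1 , _)) (inj₂ (s , e∈ , eq2)) = ⊥-elim (<-irrefl refl (subst (_≤ n) (trans eq2 eq1) (proj₂ (entry-range e∈))))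
  parent-functional (inj₂ (s , e∈ , eq2)) (inj₁ (eq1 , _)) = ⊥-elim (<-irrefl refl (subst (_≤ n) (trans eq2 eq1) (proj₂ (entry-range e∈))))
  parent-functional (inj₂ (s , e∈ , refl)) (inj₂ (s' , e'∈ , eq)) = cong proj₁ (entry-injective e∈ e'∈ (sym eq))

  -- The distance to the parent grows along parent chains, since the
  -- labels below a vertex lie between it and its parent.
  parent-dist-grows : ∀ {x y z} → Parent x y → Parent y z → ∣ x - y ∣ < ∣ y - z ∣
  parent-dist-grows (inj₁ (_ , refl)) (inj₁ (() , _))
  parent-dist-grows (inj₂ (s , e∈ , refl)) (inj₁ (refl , refl)) = dist-white-root (proj₁ (entry-range e∈)) (proj₂ (entry-range e∈))
  parent-dist-grows (inj₁ (_ , eq1)) (inj₂ (s , e∈ , eq2)) with subst (1 ≤_) (trans eq2 eq1) (proj₁ (entry-range e∈))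
  ... | ()
  parent-dist-grows {x} {y} {z} (inj₂ (sx , ex , refl)) (inj₂ (sy , ey , refl)) with parent-info ex
  ... | inj₁ eq = ⊥-elim (not-root-label sx eq)
    where
    not-root-label : ∀ t → root sy ≡ rootParent n t → ⊥
    not-root-label (node white _ _) eq = <-irrefl refl (subst (_≤ n) eq (proj₂ (entry-range ey)))
    not-root-label (node black _ _) eq with subst (1 ≤_) eq (proj₁ (entry-range ey))
    ... | ()
  ... | inj₂ (q , ts , e'∈ , s∈) = kid-dist sy ey (same-label⇒kid ey e'∈ s∈)
    where
    kid-dist : ∀ s → (z , s) ∈ P → sx ∈ kids s → ∣ root sx - root s ∣ < ∣ root s - z ∣
    kid-dist (node white l ts') e∈ k∈ with entry-ok e∈
    ... | white-node mn _ _ _ , (_ ∷ bnd) = dist-white-child (All.lookup mn (root∈labelsF k∈)) (All.lookup bnd (root∈labelsF k∈))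
    kid-dist (node black l ts') e∈ k∈ with entry-ok e∈
    ... | black-node mx _ _ _ , (_ ∷ bnd) = dist-black-child (All.lookup bnd (root∈labelsF k∈)) (All.lookup mx (root∈labelsF k∈))

  noCyc : ¬ Cycle A
  noCyc = ParentAcyclic.noCycle A Parent ∣_-_∣ adj-parent parent-functional parent-dist-grows

  isTree : IsTree n A
  isTree = (λ u v u≤ v≤ → Reach-trans (Reach-sym (reach-from-0 u u≤)) (reach-from-0 v v≤)) , noCyc

  -- Condition (3): the arc of a white entry is topmost at its left end (the
  -- child) and not at its right end (the parent has a smaller left arc);
  -- dually for black entries.
  white-topmostLeft : ∀ {p v ts} → (p , node white v ts) ∈ P → TopmostLeft A v p
  white-topmostLeft {p} {v} {ts} e∈ (ℓ , p<ℓ , b∈) = no-such-arc (φ-arc⇒entry n F alF b∈)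
    where
    no-such-arc : (v , ℓ) ≡ (0 , suc n) ⊎ ∃[ e ] (e ∈ P × arcOf e ≡ (v , ℓ)) → ⊥
    no-such-arc (inj₁ eq) with subst (1 ≤_) (cong proj₁ eq) (proj₁ (entry-range e∈))
    ... | ()
    no-such-arc (inj₂ ((p' , node white v' ts') , e'∈ , refl)) with entry-injective e∈ e'∈ refl
    ... | refl = <-irrefl refl p<ℓ
    no-such-arc (inj₂ ((p' , node black v' ts') , e'∈ , refl)) with parent-info e'∈
    ... | inj₁ eq with subst (1 ≤_) eq (proj₁ (entry-range e∈))
    ...   | ()
    no-such-arc (inj₂ ((p' , node black v' ts') , e'∈ , refl)) | inj₂ (q , ts'' , e''∈ , s∈) with entry-ok e∈
    ... | _ , (_ ∷ bnd) = <-asym p<ℓ (All.lookup bnd (root∈labelsF (same-label⇒kid e∈ e''∈ s∈)))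

  white-not-topmostRight : ∀ {p v ts} → (p , node white v ts) ∈ P → ¬ TopmostRight A v p
  white-not-topmostRight {p} {v} {ts} e∈ tr with parent-info e∈
  ... | inj₁ refl = tr (0 , proj₁ (entry-range e∈) , here refl)
  ... | inj₂ (q , ts' , e'∈ , s∈) with entry-ok e'∈
  ...   | _ , (_ ∷ bnd) = tr (q , All.lookup bnd (root∈labelsF s∈) , arc∈φ e'∈)

  black-topmostRight : ∀ {p v ts} → (p , node black v ts) ∈ P → TopmostRight A p v
  black-topmostRight {p} {v} {ts} e∈ (k , k<p , b∈) = no-such-arc (φ-arc⇒entry n F alF b∈)
    where
    no-such-arc : (k , v) ≡ (0 , suc n) ⊎ ∃[ e ] (e ∈ P × arcOf e ≡ (k , v)) → ⊥
    no-such-arc (inj₁ eq) = <-irrefl refl (subst (_≤ n) (cong proj₂ eq) (proj₂ (entry-range e∈)))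
    no-such-arc (inj₂ ((p' , node black v' ts') , e'∈ , refl)) with entry-injective e∈ e'∈ refl
    ... | refl = <-irrefl refl k<p
    no-such-arc (inj₂ ((p' , node white v' ts') , e'∈ , refl)) with parent-info e'∈
    ... | inj₁ eq = <-irrefl refl (subst (_≤ n) eq (proj₂ (entry-range e∈)))
    ... | inj₂ (q , ts'' , e''∈ , s∈) with entry-ok e∈
    ...   | _ , (_ ∷ bnd) = <-asym k<p (All.lookup bnd (root∈labelsF (same-label⇒kid e∈ e''∈ s∈)))

  black-not-topmostLeft : ∀ {p v ts} → (p , node black v ts) ∈ P → ¬ TopmostLeft A p v
  black-not-topmostLeft {p} {v} {ts} e∈ tl with parent-info e∈
  ... | inj₁ refl = tl (suc n , s≤s (proj₂ (entry-range e∈)) , here refl)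
  ... | inj₂ (q , ts' , e'∈ , s∈) with entry-ok e'∈
  ...   | _ , (_ ∷ bnd) = tl (q , All.lookup bnd (root∈labelsF s∈) , arc∈φ e'∈)

  cond3 : ∀ i j → (i , j) ∈ A → ¬ ((i , j) ≡ (0 , suc n)) →
     (TopmostLeft A i j × ¬ TopmostRight A i j) ⊎ (¬ TopmostLeft A i j × TopmostRight A i j)
  cond3 i j a∈ ne = by-arc-kind (φ-arc⇒entry n F alF a∈)
    where
    by-arc-kind : (i , j) ≡ (0 , suc n) ⊎ ∃[ e ] (e ∈ P × arcOf e ≡ (i , j)) →
         (TopmostLeft A i j × ¬ TopmostRight A i j) ⊎ (¬ TopmostLeft A i j × TopmostRight A i j)
    by-arc-kind (inj₁ eq) = ⊥-elim (ne eq)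
    by-arc-kind (inj₂ ((p , node white v ts) , e∈ , refl)) = inj₁ (white-topmostLeft e∈ , white-not-topmostRight e∈)
    by-arc-kind (inj₂ ((p , node black v ts) , e∈ , refl)) = inj₂ (black-not-topmostLeft e∈ , black-topmostRight e∈)

  altDiag : AltDiagram n A
  altDiag = arcDiag , cond1 , isTree , cond3

-- The tree of a white
-- vertex v with parent v + suc k has as children the black vertices
-- x ∈ (v , v + suc k) with an arc (v , x), in decreasing order; the tree
-- of a black vertex x = q + suc k with parent q has as children the white
-- vertices y ∈ (q , x) with an arc (y , x), in increasing order.  The forest
-- ψ collects the white roots i+1 with an arc (i+1 , n+1) and the black roots
-- i+1 with an arc (0 , i+1).

optional : Bool → PTree → List PTree → List PTree
optional true t ts = t ∷ ts
optional false t ts = ts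

module Rebuild (m : ℕ → ℕ → Bool) where
  mutual
    whiteTree : ℕ → ℕ → PTree
    whiteTree v k = node white v (whiteKids v k)
    whiteKids : ℕ → ℕ → List PTree
    whiteKids v zero = []
    whiteKids v (suc j) = optional (m v (v + suc j)) (blackTree v j) (whiteKids v j)
    blackTree : ℕ → ℕ → PTree
    blackTree q k = node black (q + suc k) (blackKids (q + suc k) q 0 k)
    blackKids : ℕ → ℕ → ℕ → ℕ → List PTree
    blackKids x q i zero = []
    blackKids x q i (suc r) = optional (m (q + suc i) x) (whiteTree (q + suc i) r) (blackKids x q (suc i) r)

  ψ-over : ℕ → List ℕ → List PTree
  ψ-over n [] = []
  ψ-over n (i ∷ is) = optional (m (suc i) (suc n)) (whiteTree (suc i) (n ∸ suc i)) (optional (m 0 (suc i)) (blackTree 0 i) (ψ-over n is))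

  ψ : ℕ → List PTree
  ψ n = ψ-over n (upTo n)

  optional-∈⁻ : ∀ {b t ts x} → x ∈ optional b t ts → (x ≡ t × b ≡ true) ⊎ x ∈ ts
  optional-∈⁻ {true} (here refl) = inj₁ (refl , refl)
  optional-∈⁻ {true} (there x∈) = inj₂ x∈
  optional-∈⁻ {false} x∈ = inj₂ x∈

  optional-∈⁺ : ∀ b t {ts x} → x ∈ ts → x ∈ optional b t ts
  optional-∈⁺ true t x∈ = there x∈
  optional-∈⁺ false t x∈ = x∈

  optional-head : ∀ {b} t ts → b ≡ true → t ∈ optional b t ts
  optional-head t ts refl = here refl

  ψ-∈⁻ : ∀ n L {t} → t ∈ ψ-over n L → ∃[ i ] (i ∈ L × ((t ≡ whiteTree (suc i) (n ∸ suc i) × m (suc i) (suc n) ≡ true) ⊎ (t ≡ blackTree 0 i × m 0 (suc i) ≡ true)))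
  ψ-∈⁻ n (i ∷ is) t∈ with optional-∈⁻ t∈
  ... | inj₁ r = i , here refl , inj₁ r
  ... | inj₂ t∈' with optional-∈⁻ t∈'
  ...   | inj₁ r = i , here refl , inj₂ r
  ...   | inj₂ t∈'' with ψ-∈⁻ n is t∈''
  ...     | j , j∈ , r = j , there j∈ , r

  ψ-∈-white : ∀ n L {i} → i ∈ L → m (suc i) (suc n) ≡ true → whiteTree (suc i) (n ∸ suc i) ∈ ψ-over n L
  ψ-∈-white n (i ∷ is) (here refl) eq = optional-head _ (optional (m 0 (suc i)) (blackTree 0 i) (ψ-over n is)) eq
  ψ-∈-white n (j ∷ is) (there i∈) eq = optional-∈⁺ (m (suc j) (suc n)) (whiteTree (suc j) (n ∸ suc j)) (optional-∈⁺ (m 0 (suc j)) (blackTree 0 j) (ψ-∈-white n is i∈ eq))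

  ψ-∈-black : ∀ n L {i} → i ∈ L → m 0 (suc i) ≡ true → blackTree 0 i ∈ ψ-over n L
  ψ-∈-black n (i ∷ is) (here refl) eq = optional-∈⁺ (m (suc i) (suc n)) (whiteTree (suc i) (n ∸ suc i)) (optional-head _ (ψ-over n is) eq)
  ψ-∈-black n (j ∷ is) (there i∈) eq = optional-∈⁺ (m (suc j) (suc n)) (whiteTree (suc j) (n ∸ suc j)) (optional-∈⁺ (m 0 (suc j)) (blackTree 0 j) (ψ-∈-black n is i∈ eq))

  roots-ψ : ∀ n L {t} → t ∈ ψ-over n L → ∃[ i ] (i ∈ L × root t ≡ suc i)
  roots-ψ n L t∈ with ψ-∈⁻ n L t∈
  ... | i , i∈ , inj₁ (refl , _) = i , i∈ , refl
  ... | i , i∈ , inj₂ (refl , _) = i , i∈ , refl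

  unique-roots-ψ : ∀ n L → Unique L → (∀ i → m 0 (suc i) ≡ true → m (suc i) (suc n) ≡ true → ⊥) →
           Unique (map root (ψ-over n L))
  unique-roots-ψ n [] u h = []
  unique-roots-ψ n (i ∷ is) (a ∷ u) h = with-white (m (suc i) (suc n)) refl
    where
    rest : Unique (map root (ψ-over n is))
    rest = unique-roots-ψ n is u h
    not-in-rest : ∀ {x} → x ∈ map root (ψ-over n is) → x ≢ suc i
    not-in-rest x∈ refl with ∈-map⁻ root x∈
    ... | t , t∈ , eq with roots-ψ n is t∈
    ...   | j , j∈ , eq2 = All.lookup a j∈ (suc-injective (trans eq eq2))
    with-black : ∀ b → Unique (map root (optional b (blackTree 0 i) (ψ-over n is)))
    with-black true = All.tabulate (λ x∈ e → not-in-rest x∈ (sym e)) ∷ rest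
    with-black false = rest
    with-white : ∀ b → m (suc i) (suc n) ≡ b → Unique (map root (optional b (whiteTree (suc i) (n ∸ suc i)) (optional (m 0 (suc i)) (blackTree 0 i) (ψ-over n is))))
    with-white false _ = with-black (m 0 (suc i))
    with-white true eqw = All.tabulate white-fresh ∷ with-black (m 0 (suc i))
      where
      white-fresh : ∀ {x} → x ∈ map root (optional (m 0 (suc i)) (blackTree 0 i) (ψ-over n is)) → suc i ≢ x
      white-fresh {x} x∈ e with m 0 (suc i) in eqb
      white-fresh {x} (here refl) e | true = h i eqb eqw
      white-fresh {x} (there x∈) e | true = not-in-rest x∈ (sym e)
      white-fresh {x} x∈ e | false = not-in-rest x∈ (sym e)

  unique-ψ-trees : ∀ n → (∀ i → m 0 (suc i) ≡ true → m (suc i) (suc n) ≡ true → ⊥) → Unique (ψ n)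
  unique-ψ-trees n h = UP.map⁻ (unique-roots-ψ n (upTo n) (UP.upTo⁺ n) h)

module RebuildExt (m m' : ℕ → ℕ → Bool) (h : ∀ a b → m a b ≡ m' a b) where
  module B = Rebuild m
  module B' = Rebuild m'
  optional-cong : ∀ {b b' t t' ts ts'} → b ≡ b' → t ≡ t' → ts ≡ ts' → optional b t ts ≡ optional b' t' ts'
  optional-cong refl refl refl = refl
  mutual
    whiteTree-ext : ∀ v k → B.whiteTree v k ≡ B'.whiteTree v k
    whiteTree-ext v k = cong (node white v) (whiteKids-ext v k)
    whiteKids-ext : ∀ v k → B.whiteKids v k ≡ B'.whiteKids v k
    whiteKids-ext v zero = refl
    whiteKids-ext v (suc j) = optional-cong (h v (v + suc j)) (blackTree-ext v j) (whiteKids-ext v j)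
    blackTree-ext : ∀ q k → B.blackTree q k ≡ B'.blackTree q k
    blackTree-ext q k = cong (node black (q + suc k)) (blackKids-ext (q + suc k) q 0 k)
    blackKids-ext : ∀ x q i r → B.blackKids x q i r ≡ B'.blackKids x q i r
    blackKids-ext x q i zero = refl
    blackKids-ext x q i (suc r) = optional-cong (h (q + suc i) x) (whiteTree-ext (q + suc i) r) (blackKids-ext x q (suc i) r)
  ψ-over-ext : ∀ n L → B.ψ-over n L ≡ B'.ψ-over n L
  ψ-over-ext n [] = refl
  ψ-over-ext n (i ∷ is) = optional-cong (h (suc i) (suc n)) (whiteTree-ext (suc i) (n ∸ suc i)) (optional-cong (h 0 (suc i)) (blackTree-ext 0 i) (ψ-over-ext n is))

_≟A_ : (a b : Arc) → Dec (a ≡ b)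
_≟A_ = ≡-dec _≟_ _≟_

oracle : List Arc → ℕ → ℕ → Bool
oracle D a b = isYes (DecMem._∈?_ _≟A_ (a , b) D)

oracle⇒∈ : ∀ {D a b} → oracle D a b ≡ true → (a , b) ∈ D
oracle⇒∈ {D} {a} {b} eq with DecMem._∈?_ _≟A_ (a , b) D
... | yes p = p
... | no _ with eq
...   | ()

∈⇒oracle : ∀ {D a b} → (a , b) ∈ D → oracle D a b ≡ true
∈⇒oracle {D} {a} {b} p with DecMem._∈?_ _≟A_ (a , b) D
... | yes _ = refl
... | no np = ⊥-elim (np p)

oracle-resp-≈A : ∀ {D D'} → D ≈A D' → ∀ a b → oracle D a b ≡ oracle D' a b
oracle-resp-≈A {D} {D'} eq a b with DecMem._∈?_ _≟A_ (a , b) D | DecMem._∈?_ _≟A_ (a , b) D'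
... | yes _ | yes _ = refl
... | no _ | no _ = refl
... | yes p | no np = ⊥-elim (np (Equivalence.to (eq (a , b)) p))
... | no np | yes p = ⊥-elim (np (Equivalence.from (eq (a , b)) p))

ψ-resp-≈A : ∀ {D D'} → D ≈A D' → ∀ n → Rebuild.ψ (oracle D) n ≡ Rebuild.ψ (oracle D') n
ψ-resp-≈A {D} {D'} eq n = RebuildExt.ψ-over-ext (oracle D) (oracle D') (oracle-resp-≈A eq) n (upTo n)

module RebuildUnique (m : ℕ → ℕ → Bool) where
  open Rebuild m

  -- Induction on the remaining range: if the
  -- largest candidate child v + suc j has an arc, it must be the head of the
  -- list (whiteKids-head), otherwise it does not occur at all.
  mutual
    whiteKids-unique : ∀ v j ts → Linked (λ a b → b < a) (map root ts) →
          All (λ t → v < root t × root t < v + suc j) ts →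
          (∀ x → v < x → x < v + suc j → m v x ≡ true → x ∈ map root ts) →
          All (λ t → m v (root t) ≡ true × (∀ j' → root t ≡ v + suc j' → blackTree v j' ≡ t)) ts →
          whiteKids v j ≡ ts
    whiteKids-unique v zero [] _ _ _ _ = refl
    whiteKids-unique v zero (t ∷ ts) _ ((a , b) ∷ _) _ _ =
      ⊥-elim (<⇒≱ a (subst (root t ≤_) (+-identityʳ v) (<m+1+n⇒≤m+n v 0 b)))
    whiteKids-unique v (suc j) ts lk rng mem hyp with m v (v + suc j) in eq
    ... | true = whiteKids-head v j ts lk rng hyp mem (mem (v + suc j) (m<m+1+n v j) (m+1+n<m+2+n v j) eq)
    ... | false = whiteKids-unique v j ts lk rng' (λ y v<y y< my → mem y v<y (<-trans y< (m+1+n<m+2+n v j)) my) hyp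
      where
      rng' : All (λ t → v < root t × root t < v + suc j) ts
      rng' = All.tabulate (λ {t} t∈ → proj₁ (All.lookup rng t∈) ,
               ≤∧≢⇒< (<m+1+n⇒≤m+n v (suc j) (proj₂ (All.lookup rng t∈)))
                   (λ e → case trans (sym (proj₁ (All.lookup hyp t∈))) (trans (cong (m v) e) eq) of λ ()))

    whiteKids-head : ∀ v j ts → Linked (λ a b → b < a) (map root ts) →
         All (λ t → v < root t × root t < v + suc (suc j)) ts →
         All (λ t → m v (root t) ≡ true × (∀ j' → root t ≡ v + suc j' → blackTree v j' ≡ t)) ts →
         (∀ x → v < x → x < v + suc (suc j) → m v x ≡ true → x ∈ map root ts) →
         v + suc j ∈ map root ts → blackTree v j ∷ whiteKids v j ≡ ts
    whiteKids-head v j (t ∷ ts') lk ((a , b) ∷ rng') (h ∷ hyp') mem x∈ = cong₂ _∷_ (proj₂ h j rt) ih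
      where
      tailLt : All (_< root t) (map root ts')
      tailLt = Linked⇒All-head (λ p q → <-trans q p) lk
      rtH : v + suc j ∈ map root (t ∷ ts') → root t ≡ v + suc j
      rtH (here e) = sym e
      rtH (there x∈') = ⊥-elim (<⇒≱ (All.lookup tailLt x∈') (<m+1+n⇒≤m+n v (suc j) b))
      rt : root t ≡ v + suc j
      rt = rtH x∈
      ih : whiteKids v j ≡ ts'
      ih = whiteKids-unique v j ts' (Linked.tail lk)
             (All.tabulate (λ {t'} t'∈ → proj₁ (All.lookup rng' t'∈) ,
                subst (root t' <_) rt (All.lookup tailLt (∈-map⁺ root t'∈))))
             (λ y v<y y< my → case mem y v<y (<-trans y< (m+1+n<m+2+n v j)) my of λ
                { (here e) → ⊥-elim (<-irrefl (trans e rt) y<)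
                ; (there y∈) → y∈ })
             hyp'

  -- The same for the kids of a black vertex x = q + suc k, scanned upwards
  -- from the smallest candidate q + suc i.
  mutual
    blackKids-unique : ∀ x q i r ts → Linked _<_ (map root ts) →
          All (λ t → q + i < root t × root t < x) ts →
          (∀ y → q + i < y → y < x → m y x ≡ true → y ∈ map root ts) →
          All (λ t → m (root t) x ≡ true × (∀ r' → root t + suc r' ≡ x → whiteTree (root t) r' ≡ t)) ts →
          q + suc (i + r) ≡ x → blackKids x q i r ≡ ts
    blackKids-unique x q i zero [] _ _ _ _ _ = refl
    blackKids-unique x q i zero (t ∷ ts) _ ((a , b) ∷ _) _ _ refl =
      ⊥-elim (<⇒≱ a (<m+1+n⇒≤m+n q i (subst (λ z → root t < q + suc z) (+-identityʳ i) b)))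
    blackKids-unique x q i (suc r) ts lk rng mem hyp inv with m (q + suc i) x in eq
    ... | true = blackKids-head x q i r ts lk rng hyp mem inv (mem (q + suc i) (+-monoʳ-< q (n<1+n i)) q+suc-i<x eq)
      where
      q+suc-i<x : q + suc i < x
      q+suc-i<x = subst (q + suc i <_) inv (+-monoʳ-< q (s≤s (m<m+n i (s≤s z≤n))))
    ... | false = blackKids-unique x q (suc i) r ts lk rng' (λ y q< y< my → mem y (<-trans (+-monoʳ-< q (n<1+n i)) q<) y< my) hyp
                    (trans (cong (λ z → q + suc z) (sym (+-suc i r))) inv)
      where
      rng' : All (λ t → q + suc i < root t × root t < x) ts
      rng' = All.tabulate (λ {t} t∈ →
               ≤∧≢⇒< (subst (_≤ root t) (sym (+-suc q i)) (proj₁ (All.lookup rng t∈)))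
                   (λ e → case trans (sym (proj₁ (All.lookup hyp t∈))) (trans (cong (λ z → m z x) (sym e)) eq) of λ ()) ,
               proj₂ (All.lookup rng t∈))

    blackKids-head : ∀ x q i r ts → Linked _<_ (map root ts) →
         All (λ t → q + i < root t × root t < x) ts →
         All (λ t → m (root t) x ≡ true × (∀ r' → root t + suc r' ≡ x → whiteTree (root t) r' ≡ t)) ts →
         (∀ y → q + i < y → y < x → m y x ≡ true → y ∈ map root ts) →
         q + suc (i + suc r) ≡ x →
         q + suc i ∈ map root ts → whiteTree (q + suc i) r ∷ blackKids x q (suc i) r ≡ ts
    blackKids-head x q i r (t ∷ ts') lk ((a , b) ∷ rng') (h ∷ hyp') mem inv y∈ =
      cong₂ _∷_ (subst (λ z → whiteTree z r ≡ t) rt (proj₂ h r (trans (cong (λ z → z + suc r) rt) inv1))) ih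
      where
      inv1 : q + suc i + suc r ≡ x
      inv1 = trans (+-assoc q (suc i) (suc r)) inv
      tailGt : All (root t <_) (map root ts')
      tailGt = Linked⇒All-head <-trans lk
      rtH : q + suc i ∈ map root (t ∷ ts') → root t ≡ q + suc i
      rtH (here e) = sym e
      rtH (there y∈') = ⊥-elim (<⇒≱ (All.lookup tailGt y∈') (subst (_≤ root t) (sym (+-suc q i)) a))
      rt : root t ≡ q + suc i
      rt = rtH y∈
      ih : blackKids x q (suc i) r ≡ ts'
      ih = blackKids-unique x q (suc i) r ts' (Linked.tail lk)
             (All.tabulate (λ {t'} t'∈ → subst (_< root t') rt (All.lookup tailGt (∈-map⁺ root t'∈)) ,
                proj₂ (All.lookup rng' t'∈)))
             (λ y q< y< my → case mem y (<-trans (+-monoʳ-< q (n<1+n i)) q<) y< my of λ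
                { (here e) → ⊥-elim (<-irrefl (sym (trans e rt)) q<)
                ; (there y∈) → y∈ })
             hyp' (trans (cong (λ z → q + suc z) (sym (+-suc i r))) inv)

module Recover (n : ℕ) (F : List PTree) (af : AltForest n F) where
  open ForestToDiagram n F af
  m : ℕ → ℕ → Bool
  m = oracle A
  open Rebuild m
  open RebuildUnique m

  white-kids-complete : ∀ {p v ts} → (p , node white v ts) ∈ P → ∀ x → x < p → (v , x) ∈ A → x ∈ map root ts
  white-kids-complete {p} {v} {ts} e∈ x x<p a∈ = by-arc-kind (φ-arc⇒entry n F alF a∈)
    where
    by-arc-kind : (v , x) ≡ (0 , suc n) ⊎ ∃[ e ] (e ∈ P × arcOf e ≡ (v , x)) → x ∈ map root ts
    by-arc-kind (inj₁ eq) with subst (1 ≤_) (cong proj₁ eq) (proj₁ (entry-range e∈))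
    ... | ()
    by-arc-kind (inj₂ ((p' , node white v' ts') , e'∈ , refl)) with entry-injective e∈ e'∈ refl
    ... | refl = ⊥-elim (<-irrefl refl x<p)
    by-arc-kind (inj₂ ((p' , node black v' ts') , e'∈ , refl)) with parent-info e'∈
    ... | inj₁ eq with subst (1 ≤_) eq (proj₁ (entry-range e∈))
    ...   | ()
    by-arc-kind (inj₂ ((p' , node black v' ts') , e'∈ , refl)) | inj₂ (q , ts'' , e''∈ , s∈) = ∈-map⁺ root (same-label⇒kid e∈ e''∈ s∈)

  black-kids-complete : ∀ {q x ts} → (q , node black x ts) ∈ P → ∀ y → q < y → (y , x) ∈ A → y ∈ map root ts
  black-kids-complete {q} {x} {ts} e∈ y q<y a∈ = by-arc-kind (φ-arc⇒entry n F alF a∈)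
    where
    by-arc-kind : (y , x) ≡ (0 , suc n) ⊎ ∃[ e ] (e ∈ P × arcOf e ≡ (y , x)) → y ∈ map root ts
    by-arc-kind (inj₁ eq) = ⊥-elim (<-irrefl refl (subst (_≤ n) (cong proj₂ eq) (proj₂ (entry-range e∈))))
    by-arc-kind (inj₂ ((p' , node black v' ts') , e'∈ , refl)) with entry-injective e∈ e'∈ refl
    ... | refl = ⊥-elim (<-irrefl refl q<y)
    by-arc-kind (inj₂ ((p' , node white v' ts') , e'∈ , refl)) with parent-info e'∈
    ... | inj₁ eq = ⊥-elim (<-irrefl refl (subst (_≤ n) eq (proj₂ (entry-range e∈))))
    ... | inj₂ (q' , ts'' , e''∈ , s∈) = ∈-map⁺ root (same-label⇒kid e∈ e''∈ s∈)

  mutual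
    rebuild-white : ∀ v ts {p} → (p , node white v ts) ∈ P → ∀ k → p ≡ v + suc k → whiteTree v k ≡ node white v ts
    rebuild-white v ts {p} e∈ k eq with entry-ok e∈
    ... | white-node mn col lk al , (_ ∷ bnd) =
      cong (node white v) (whiteKids-unique v k ts lk
        (All.tabulate (λ {t} t∈ → All.lookup mn (root∈labelsF t∈) , subst (root t <_) eq (All.lookup bnd (root∈labelsF t∈))))
        (λ x v<x x< mt → white-kids-complete e∈ x (subst (x <_) (sym eq) x<) (oracle⇒∈ mt))
        (rebuild-whiteKids v ts (λ t∈ → child-entryR {n} {F} e∈ t∈) col))
    rebuild-whiteKids : ∀ v ts → (∀ {t} → t ∈ ts → (v , t) ∈ P) → All (λ t → color t ≡ black) ts →
            All (λ t → m v (root t) ≡ true × (∀ j' → root t ≡ v + suc j' → blackTree v j' ≡ t)) ts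
    rebuild-whiteKids v [] _ _ = []
    rebuild-whiteKids v (node black x ts' ∷ ts) sub (refl ∷ cols) =
      (∈⇒oracle (arc∈φ (sub (here refl))) , λ j' eq → rebuild-black x ts' (sub (here refl)) j' eq)
      ∷ rebuild-whiteKids v ts (λ t∈ → sub (there t∈)) cols
    rebuild-black : ∀ x ts {q} → (q , node black x ts) ∈ P → ∀ k → x ≡ q + suc k → blackTree q k ≡ node black x ts
    rebuild-black x ts {q} e∈ k refl with entry-ok e∈
    ... | black-node mx col lk al , (q<x ∷ bnd) =
      cong (node black (q + suc k)) (blackKids-unique (q + suc k) q 0 k ts lk
        (All.tabulate (λ {t} t∈ → subst (_< root t) (sym (+-identityʳ q)) (All.lookup bnd (root∈labelsF t∈)) , All.lookup mx (root∈labelsF t∈)))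
        (λ y q< y< mt → black-kids-complete e∈ y (subst (_< y) (+-identityʳ q) q<) (oracle⇒∈ mt))
        (rebuild-blackKids (q + suc k) ts (λ t∈ → child-entryR {n} {F} e∈ t∈) col) refl)
    rebuild-blackKids : ∀ x ts → (∀ {t} → t ∈ ts → (x , t) ∈ P) → All (λ t → color t ≡ white) ts →
            All (λ t → m (root t) x ≡ true × (∀ r' → root t + suc r' ≡ x → whiteTree (root t) r' ≡ t)) ts
    rebuild-blackKids x [] _ _ = []
    rebuild-blackKids x (node white y ts' ∷ ts) sub (refl ∷ cols) =
      (∈⇒oracle (arc∈φ (sub (here refl))) , λ r' eq → rebuild-white y ts' (sub (here refl)) r' (sym eq))
      ∷ rebuild-blackKids x ts (λ t∈ → sub (there t∈)) cols

  -- no point is both a white root and a black root, by condition (1)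
  unique-ψ : Unique (ψ n)
  unique-ψ = unique-ψ-trees n (λ i e1 e2 → cond1 0 (suc i) (suc n) (oracle⇒∈ e1) (oracle⇒∈ e2))

  unique-F : Unique F
  unique-F = unique-labels⇒unique-trees F (unique-labels af)

  F⊆ψ : ∀ t → t ∈ F → t ∈ ψ n
  F⊆ψ (node white w ts) t∈ with root-entry {n} {F} t∈
  ... | e∈ with entry-range e∈
  ...   | (s≤s {n = i} z≤n) , le =
    subst (_∈ ψ n) (rebuild-white (suc i) ts e∈ (n ∸ suc i) (suc-split i le))
      (ψ-∈-white n (upTo n) (∈-upTo⁺ le) (∈⇒oracle (arc∈φ e∈)))
  F⊆ψ (node black w ts) t∈ with root-entry {n} {F} t∈
  ... | e∈ with entry-range e∈
  ...   | (s≤s {n = i} z≤n) , le =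
    subst (_∈ ψ n) (rebuild-black (suc i) ts e∈ i refl)
      (ψ-∈-black n (upTo n) (∈-upTo⁺ le) (∈⇒oracle (arc∈φ e∈)))

  ψ⊆F : ∀ t → t ∈ ψ n → t ∈ F
  ψ⊆F t t∈ with ψ-∈⁻ n (upTo n) t∈
  ... | i , i∈ , inj₁ (refl , mt) = white-root∈F (φ-arc⇒entry n F alF (oracle⇒∈ mt))
    where
    white-root∈F : (suc i , suc n) ≡ (0 , suc n) ⊎ ∃[ e ] (e ∈ P × arcOf e ≡ (suc i , suc n)) → whiteTree (suc i) (n ∸ suc i) ∈ F
    white-root∈F (inj₁ ())
    white-root∈F (inj₂ ((p' , node black v' ts') , e'∈ , refl)) = ⊥-elim (<-irrefl refl (proj₂ (entry-range e'∈)))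
    white-root∈F (inj₂ ((p' , node white v' ts') , e'∈ , refl)) with parent-entryR {n} {F} e'∈
    ... | inj₁ (_ , s∈) = subst (_∈ F) (sym (rebuild-white (suc i) ts' e'∈ (n ∸ suc i) (suc-split i (∈-upTo⁻ i∈)))) s∈
    ... | inj₂ (q , c , ts'' , e''∈ , _) = ⊥-elim (<-irrefl refl (proj₂ (entry-range e''∈)))
  ... | i , i∈ , inj₂ (refl , mt) = black-root∈F (φ-arc⇒entry n F alF (oracle⇒∈ mt))
    where
    black-root∈F : (0 , suc i) ≡ (0 , suc n) ⊎ ∃[ e ] (e ∈ P × arcOf e ≡ (0 , suc i)) → blackTree 0 i ∈ F
    black-root∈F (inj₁ refl) = ⊥-elim (<-irrefl refl (∈-upTo⁻ i∈))
    black-root∈F (inj₂ ((p' , node white v' ts') , e'∈ , refl)) with proj₁ (entry-range e'∈)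
    ... | ()
    black-root∈F (inj₂ ((p' , node black v' ts') , e'∈ , refl)) with parent-entryR {n} {F} e'∈
    ... | inj₁ (_ , s∈) = subst (_∈ F) (sym (rebuild-black (suc i) ts' e'∈ i refl)) s∈
    ... | inj₂ (q , c , ts'' , e''∈ , _) with proj₁ (entry-range e''∈)
    ...   | ()

  ψ↭F : ψ n ↭ F
  ψ↭F = unique-sameElements⇒↭ unique-ψ unique-F ψ⊆F F⊆ψ

module RebuildAlt (m : ℕ → ℕ → Bool) where
  open Rebuild m

  WhiteKidsOK : ℕ → ℕ → List PTree → Set
  WhiteKidsOK v j ts = All AltTree ts × All (λ t → color t ≡ black) ts ×
              All (λ t → All (λ z → v < z × z < v + suc j) (labels t)) ts ×
              Linked (λ a b → b < a) (map root ts)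

  BlackKidsOK : ℕ → ℕ → List PTree → Set
  BlackKidsOK lo x ts = All AltTree ts × All (λ t → color t ≡ white) ts ×
               All (λ t → All (λ z → lo < z × z < x) (labels t)) ts ×
               Linked _<_ (map root ts)

  mutual
    alt-whiteTree : ∀ v k → AltTree (whiteTree v k) × All (λ z → v ≤ z × z < v + suc k) (labels (whiteTree v k))
    alt-whiteTree v k with alt-whiteKids v k
    ... | al , col , rng , lk =
      white-node (All.map proj₁ (All-labelsF (whiteKids v k) rng)) col lk al ,
      (≤-refl , m<m+1+n v k) ∷ All.map (λ (a , b) → <⇒≤ a , b) (All-labelsF (whiteKids v k) rng)
    alt-whiteKids : ∀ v j → WhiteKidsOK v j (whiteKids v j)
    alt-whiteKids v zero = [] , [] , [] , []
    alt-whiteKids v (suc j) with m v (v + suc j) | alt-whiteKids v j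
    ... | false | al , col , rng , lk = al , col , All.map (All.map (λ (a , b) → a , <-trans b (m+1+n<m+2+n v j))) rng , lk
    ... | true | al , col , rng , lk with alt-blackTree v j
    ...   | at , rb =
      (at ∷ al) , (refl ∷ col) ,
      (All.map (λ {z} (a , b) → a , subst (z <_) (sym (+-suc v (suc j))) (s≤s b)) rb
        ∷ All.map (All.map (λ (a , b) → a , <-trans b (m+1+n<m+2+n v j))) rng) ,
      Linked-cons (All.tabulate (λ {x} x∈ → case ∈-map⁻ root x∈ of λ
                   { (t , t∈ , refl) → proj₂ (All.lookup (All.lookup rng t∈) (root∈labels t)) })) lk
    alt-blackTree : ∀ q k → AltTree (blackTree q k) × All (λ z → q < z × z ≤ q + suc k) (labels (blackTree q k))
    alt-blackTree q k with alt-blackKids (q + suc k) q 0 k refl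
    ... | al , col , rng , lk =
      black-node (All.map proj₂ (All-labelsF _ rng)) col lk al ,
      (m<m+n q (s≤s z≤n) , ≤-refl) ∷
        All.map (λ (a , b) → subst (_< _) (+-identityʳ q) a , <⇒≤ b) (All-labelsF _ rng)
    alt-blackKids : ∀ x q i r → q + suc (i + r) ≡ x → BlackKidsOK (q + i) x (blackKids x q i r)
    alt-blackKids x q i zero inv = [] , [] , [] , []
    alt-blackKids x q i (suc r) inv with m (q + suc i) x | alt-blackKids x q (suc i) r (trans (cong (λ z → q + suc z) (sym (+-suc i r))) inv)
    ... | false | al , col , rng , lk =
      al , col , All.map (All.map (λ (a , b) → <-trans (+-monoʳ-< q (n<1+n i)) a , b)) rng , lk
    ... | true | al , col , rng , lk with alt-whiteTree (q + suc i) r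
    ...   | at , rw =
      (at ∷ al) , (refl ∷ col) ,
      (All.map (λ (a , b) → <-≤-trans (+-monoʳ-< q (n<1+n i)) a ,
                 subst (_ <_) (trans (+-assoc q (suc i) (suc r)) inv) b) rw
        ∷ All.map (All.map (λ (a , b) → <-trans (+-monoʳ-< q (n<1+n i)) a , b)) rng) ,
      Linked-cons (All.tabulate (λ {z} z∈ → case ∈-map⁻ root z∈ of λ
                   { (t , t∈ , refl) → proj₁ (All.lookup (All.lookup rng t∈) (root∈labels t)) })) lk

  whiteKids-complete : ∀ v k j → j < k → m v (v + suc j) ≡ true → blackTree v j ∈ whiteKids v k
  whiteKids-complete v (suc k) j j<k eq with j ≟ k
  ... | yes refl rewrite eq = here refl
  ... | no ne = optional-∈⁺ (m v (v + suc k)) (blackTree v k) (whiteKids-complete v k j (≤∧≢⇒< (s≤s⁻¹ j<k) ne) eq)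

  blackKids-complete : ∀ x q i r j → i ≤ j → j < i + r → m (q + suc j) x ≡ true → ∃[ r' ] (whiteTree (q + suc j) r' ∈ blackKids x q i r)
  blackKids-complete x q i zero j i≤j j< eq = ⊥-elim (<-irrefl refl (≤-<-trans i≤j (subst (j <_) (+-identityʳ i) j<)))
  blackKids-complete x q i (suc r) j i≤j j< eq with i ≟ j
  ... | yes refl rewrite eq = r , here refl
  ... | no ne with blackKids-complete x q (suc i) r j (≤∧≢⇒< i≤j ne) (subst (j <_) (+-suc i r) j< ) eq
  ...   | r' , mem = r' , optional-∈⁺ (m (q + suc i) x) (whiteTree (q + suc i) r) mem

-- The parent structure of an alternative diagram D: the parent of a point
-- x ∈ {1,…,n} is the other end of the arc that is topmost at x.
module DiagramParents (n : ℕ) (D : List Arc) (hD : AltDiagram n D) where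
  ad : ArcDiagram n D
  ad = proj₁ hD
  cond1 : ∀ k i j → (k , i) ∈ D → (i , j) ∈ D → ⊥
  cond1 = proj₁ (proj₂ hD)
  conn : ∀ u v → u ≤ suc n → v ≤ suc n → Reach D u v
  conn = proj₁ (proj₁ (proj₂ (proj₂ hD)))
  cond3 : ∀ i j → (i , j) ∈ D → ¬ ((i , j) ≡ (0 , suc n)) →
     (TopmostLeft D i j × ¬ TopmostRight D i j) ⊎ (¬ TopmostLeft D i j × TopmostRight D i j)
  cond3 = proj₂ (proj₂ (proj₂ hD))

  arc-bound : ∀ {a b} → (a , b) ∈ D → a < b × b ≤ suc n
  arc-bound a∈ = All.lookup ad a∈

  arc? : ∀ a b → Dec ((a , b) ∈ D)
  arc? a b = DecMem._∈?_ _≟A_ (a , b) D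

  TL TR : ℕ → ℕ → Set
  TL = TopmostLeft D
  TR = TopmostRight D

  last-step : ∀ {v} → Reach D 0 v → v ≢ 0 → ∃[ w ] (Adj D w v)
  last-step here ne = ⊥-elim (ne refl)
  last-step (step r a) ne = _ , a

  topmostLeft-top : ∀ {k} → TL k (suc n)
  topmostLeft-top (ℓ , lt , a∈) = <-irrefl refl (<-≤-trans lt (proj₂ (arc-bound a∈)))

  -- The arc (0 , n+1) belongs to D: n+1 is reached from 0, so it ends some
  -- arc; the leftmost such arc is topmost at n+1, so by (3) it starts at 0.
  top-arc∈ : (0 , suc n) ∈ D
  top-arc∈ with last-step (conn 0 (suc n) z≤n ≤-refl) (λ ())
  ... | w , inj₂ a∈ = ⊥-elim (<-irrefl refl (<-≤-trans (proj₁ (arc-bound a∈)) (proj₂ (arc-bound a∈))))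
  ... | w , inj₁ a∈ with least-witness (λ k → arc? k (suc n)) w a∈
  ...   | k , _ , k∈ , mn with k ≟ 0
  ...     | yes refl = k∈
  ...     | no ne with cond3 k (suc n) k∈ (λ eq → ne (cong proj₁ eq))
  ...       | inj₁ (_ , ntr) = ⊥-elim (ntr (λ (z , z<k , z∈) → mn z z<k z∈))
  ...       | inj₂ (ntl , _) = ⊥-elim (ntl topmostLeft-top)

  ¬topmostRight⇒arc : ∀ {i j} → ¬ TR i j → ∃[ k ] (k < i × (k , j) ∈ D)
  ¬topmostRight⇒arc {i} {j} ntr with search-below (λ k → arc? k j) i
  ... | yes w = w
  ... | no nw = ⊥-elim (ntr (λ (k , k<i , k∈) → nw (k , k<i , k∈)))

  ¬topmostLeft⇒arc : ∀ {i j} → ¬ TL i j → ∃[ ℓ ] (j < ℓ × (i , ℓ) ∈ D)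
  ¬topmostLeft⇒arc {i} {j} ntl with search-below (λ ℓ → (j <? ℓ) ×-dec (arc? i ℓ)) (suc (suc n))
  ... | yes (ℓ , _ , j<ℓ , ℓ∈) = ℓ , j<ℓ , ℓ∈
  ... | no nw = ⊥-elim (ntl (λ (ℓ , j<ℓ , ℓ∈) → nw (ℓ , s≤s (proj₂ (arc-bound ℓ∈)) , j<ℓ , ℓ∈)))

  Parent : ℕ → ℕ → Set
  Parent x y = (1 ≤ x × x ≤ n) × ((x < y × (x , y) ∈ D × TL x y) ⊎ (y < x × (y , x) ∈ D × TR y x))

  parent-arc< : ∀ {x y} → Parent x y → x < y → (x , y) ∈ D
  parent-arc< (_ , inj₁ (_ , a , _)) _ = a
  parent-arc< (_ , inj₂ (y<x , _)) x<y = ⊥-elim (<-asym x<y y<x)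

  parent-arc> : ∀ {x y} → Parent x y → y < x → (y , x) ∈ D
  parent-arc> (_ , inj₂ (_ , a , _)) _ = a
  parent-arc> (_ , inj₁ (x<y , _)) y<x = ⊥-elim (<-asym x<y y<x)

  parent-bound : ∀ {x y} → Parent x y → y ≤ suc n
  parent-bound (_ , inj₁ (_ , a , _)) = proj₂ (arc-bound a)
  parent-bound ((_ , x≤n) , inj₂ (y<x , _)) = <⇒≤ (<-≤-trans y<x (m≤n⇒m≤1+n x≤n))

  -- a point has at most one parent: two arcs topmost at x on the same side
  -- coincide, and on opposite sides they would violate (1)
  parent-functional : ∀ {x y y'} → Parent x y → Parent x y' → y ≡ y'
  parent-functional {x} {y} {y'} (_ , inj₁ (x<y , a , tl)) (_ , inj₁ (x<y' , a' , tl')) with <-cmp y y'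
  ... | tri< lt _ _ = ⊥-elim (tl (y' , lt , a'))
  ... | tri≈ _ eq _ = eq
  ... | tri> _ _ gt = ⊥-elim (tl' (y , gt , a))
  parent-functional {x} {y} {y'} (_ , inj₂ (y<x , a , tr)) (_ , inj₂ (y'<x , a' , tr')) with <-cmp y y'
  ... | tri< lt _ _ = ⊥-elim (tr' (y , lt , a))
  ... | tri≈ _ eq _ = eq
  ... | tri> _ _ gt = ⊥-elim (tr (y' , gt , a'))
  parent-functional (_ , inj₁ (_ , a , _)) (_ , inj₂ (_ , a' , _)) = ⊥-elim (cond1 _ _ _ a' a)
  parent-functional (_ , inj₂ (_ , a , _)) (_ , inj₁ (_ , a' , _)) = ⊥-elim (cond1 _ _ _ a a')

  -- The distance to the parent grows along parent chains: by (1) the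
  -- grandparent z lies on the same side of the parent y as x, and as the
  -- arc x–y is not topmost at y while z–y is, z lies beyond x.
  parent-dist-grows : ∀ {x y z} → Parent x y → Parent y z → ∣ x - y ∣ < ∣ y - z ∣
  parent-dist-grows {x} {y} {z} ((1≤x , x≤n) , inj₁ (x<y , a , tl)) (_ , py) = by-grandparent-arc py
    where
    ntr : ¬ TR x y
    ntr with cond3 x y a (λ eq → case subst (1 ≤_) (cong proj₁ eq) 1≤x of λ ())
    ... | inj₁ (_ , ntr) = ntr
    ... | inj₂ (ntl , _) = ⊥-elim (ntl tl)
    by-grandparent-arc : (y < z × (y , z) ∈ D × TL y z) ⊎ (z < y × (z , y) ∈ D × TR z y) → ∣ x - y ∣ < ∣ y - z ∣
    by-grandparent-arc (inj₁ (_ , a' , _)) = ⊥-elim (cond1 x y z a a')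
    by-grandparent-arc (inj₂ (z<y , a' , tr')) with ¬topmostRight⇒arc ntr
    ... | k , k<x , k∈ = dist-black-child (≤-<-trans (≮⇒≥ (λ k<z → tr' (k , k<z , k∈))) k<x) x<y
  parent-dist-grows {x} {y} {z} ((1≤x , x≤n) , inj₂ (y<x , a , tr)) (_ , py) = by-grandparent-arc py
    where
    ntl : ¬ TL y x
    ntl with cond3 y x a (λ eq → <-irrefl refl (subst (_≤ n) (cong proj₂ eq) x≤n))
    ... | inj₁ (_ , ntr) = ⊥-elim (ntr tr)
    ... | inj₂ (ntl , _) = ntl
    by-grandparent-arc : (y < z × (y , z) ∈ D × TL y z) ⊎ (z < y × (z , y) ∈ D × TR z y) → ∣ x - y ∣ < ∣ y - z ∣
    by-grandparent-arc (inj₂ (_ , a' , _)) = ⊥-elim (cond1 z y x a' a)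
    by-grandparent-arc (inj₁ (y<z , a' , tl')) with ¬topmostLeft⇒arc ntl
    ... | ℓ , x<ℓ , ℓ∈ = dist-white-child y<x (<-≤-trans x<ℓ (≮⇒≥ (λ z<ℓ → tl' (ℓ , z<ℓ , ℓ∈))))

  -- Every point of {1,…,n} has a parent: the extreme arc reaching it.
  parent-exists : ∀ v → 1 ≤ v → v ≤ n → ∃[ u ] Parent v u
  parent-exists v 1≤v v≤n with last-step (conn 0 v z≤n (m≤n⇒m≤1+n v≤n)) (λ { refl → case 1≤v of λ () })
  ... | w , inj₁ a∈ with least-witness (λ k → arc? k v) w a∈
  ...   | k , _ , k∈ , mn = k , (1≤v , v≤n) , inj₂ (proj₁ (arc-bound k∈) , k∈ , λ (z , z<k , z∈) → mn z z<k z∈)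
  parent-exists v 1≤v v≤n | w , inj₂ a∈ with largest-witness (λ ℓ → arc? v ℓ) (suc (suc n)) w (s≤s (proj₂ (arc-bound a∈))) a∈
  ...   | y , _ , _ , y∈ , mx = y , (1≤v , v≤n) , inj₁ (proj₁ (arc-bound y∈) , y∈ ,
            λ (ℓ , y<ℓ , ℓ∈) → mx ℓ y<ℓ (s≤s (proj₂ (arc-bound ℓ∈))) ℓ∈)

  -- Every arc of D other than (0 , n+1) joins a point of {1,…,n} to its
  -- parent: by condition (3) it is topmost at exactly one end, the child.
  topmostLeft⇒parent : ∀ {i j} → (i , j) ∈ D → (i , j) ≢ (0 , suc n) → TL i j → Parent i j
  topmostLeft⇒parent {zero} a∈ ne tl =
    ⊥-elim (tl (suc n , ≤∧≢⇒< (proj₂ (arc-bound a∈)) (λ e → ne (cong (0 ,_) e)) , top-arc∈))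
  topmostLeft⇒parent {suc i} a∈ ne tl =
    (s≤s z≤n , s≤s⁻¹ (<-≤-trans (proj₁ (arc-bound a∈)) (proj₂ (arc-bound a∈)))) , inj₁ (proj₁ (arc-bound a∈) , a∈ , tl)

  topmostRight⇒parent : ∀ {i j} → (i , j) ∈ D → (i , j) ≢ (0 , suc n) → TR i j → Parent j i
  topmostRight⇒parent {i} {j} a∈ ne tr with j ≟ suc n
  ... | no j≢ =
    (≤-trans (s≤s z≤n) (proj₁ (arc-bound a∈)) , s≤s⁻¹ (≤∧≢⇒< (proj₂ (arc-bound a∈)) j≢)) , inj₂ (proj₁ (arc-bound a∈) , a∈ , tr)
  topmostRight⇒parent {zero} a∈ ne tr | yes refl = ⊥-elim (ne refl)
  topmostRight⇒parent {suc i} a∈ ne tr | yes refl = ⊥-elim (tr (0 , s≤s z≤n , top-arc∈))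

  arc⇒parent : ∀ {i j} → (i , j) ∈ D → (i , j) ≢ (0 , suc n) → Parent i j ⊎ Parent j i
  arc⇒parent {i} {j} a∈ ne with cond3 i j a∈ ne
  ... | inj₁ (tl , _) = inj₁ (topmostLeft⇒parent a∈ ne tl)
  ... | inj₂ (_ , tr) = inj₂ (topmostRight⇒parent a∈ ne tr)

  data Anc (a : ℕ) : ℕ → Set where
    self : Anc a a
    up : ∀ {z y} → Parent z y → Anc a y → Anc a z

  anc-trans : ∀ {a b z} → Anc a b → Anc b z → Anc a z
  anc-trans r self = r
  anc-trans r (up p s) = up p (anc-trans r s)

  anc-comparable : ∀ {a b z} → Anc a z → Anc b z → Anc a b ⊎ Anc b a
  anc-comparable self s = inj₂ s
  anc-comparable (up p r) self = inj₁ (up p r)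
  anc-comparable (up p r) (up p' r') with parent-functional p p'
  ... | refl = anc-comparable r r'

  anc-parent : ∀ {x y u} → Anc x y → Parent x u → ∃[ w ] Parent y w
  anc-parent self p = _ , p
  anc-parent (up p _) _ = _ , p

  parent-dist-mono : ∀ {x y u} → Anc x y → Parent x u → ∀ {w} → Parent y w → ∣ y - w ∣ ≤ ∣ x - u ∣
  parent-dist-mono self p q with parent-functional p q
  ... | refl = ≤-refl
  parent-dist-mono (up p1 a) pxu q with parent-functional q p1
  ... | refl with anc-parent a pxu
  ...   | w' , p2 = <⇒≤ (<-≤-trans (parent-dist-grows p1 p2) (parent-dist-mono a pxu p2))

  parent-irrefl : ∀ {x} → Parent x x → ⊥
  parent-irrefl (_ , inj₁ (lt , _)) = <-irrefl refl lt
  parent-irrefl (_ , inj₂ (lt , _)) = <-irrefl refl lt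

  parent-no-loop : ∀ {x y} → Parent x y → Anc x y → ⊥
  parent-no-loop p self = parent-irrefl p
  parent-no-loop p (up q a) = <-irrefl refl (<-≤-trans (parent-dist-grows p q) (parent-dist-mono (up q a) p q))

  anc-step : ∀ {a b y} → Anc a b → a ≢ b → Parent b y → Anc a y
  anc-step self ne _ = ⊥-elim (ne refl)
  anc-step (up p r) ne q with parent-functional q p
  ... | refl = r

  siblings-disjoint : ∀ {a b l z} → Parent a l → Parent b l → a ≢ b → Anc a z → Anc b z → ⊥
  siblings-disjoint pa pb ne ra rb with anc-comparable ra rb
  ... | inj₁ ab = parent-no-loop pa (anc-step ab ne pb)
  ... | inj₂ ba = parent-no-loop pb (anc-step ba (λ e → ne (sym e)) pa)

  -- the virtual parents 0 and n+1 are not labels, so they have no ancestors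
  Special : ℕ → Set
  Special y = y ≡ 0 ⊎ y ≡ suc n

  special-not-label : ∀ {a y} → Parent a y → Special y → ∀ {y'} → Anc y' y → (1 ≤ y' × y' ≤ n) → ⊥
  special-not-label _ (inj₁ refl) self (() , _)
  special-not-label _ (inj₂ refl) self (_ , le) = <-irrefl refl le
  special-not-label _ (inj₁ refl) (up ((() , _) , _) _) _
  special-not-label _ (inj₂ refl) (up ((_ , le) , _) _) _ = <-irrefl refl le

  roots-disjoint : ∀ {a b y1 y2 z} → Parent a y1 → Parent b y2 → Special y1 → Special y2 → a ≢ b → Anc a z → Anc b z → ⊥
  roots-disjoint pa pb s1 s2 ne ra rb with anc-comparable ra rb
  ... | inj₁ ab = special-not-label pb s2 (anc-step ab ne pb) (proj₁ pa)
  ... | inj₂ ba = special-not-label pa s1 (anc-step ba (λ e → ne (sym e)) pa) (proj₁ pb)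

module DiagramToForest (n : ℕ) (D : List Arc) (hD : AltDiagram n D) where
  open DiagramParents n D hD

  m : ℕ → ℕ → Bool
  m = oracle D
  open Rebuild m
  open RebuildAlt m

  -- Every entry of ψ is the entry of a rebuilt tree hanging from its D-parent.
  Shape : ℕ → PTree → Set
  Shape p s = (∃[ v ] ∃[ k ] (s ≡ whiteTree v k × p ≡ v + suc k)) ⊎ (∃[ k ] (s ≡ blackTree p k))

  EntryInv : Entry → Set
  EntryInv (p , s) = Parent (root s) p × Shape p s

  -- A D-child of a vertex: an arc from a white vertex v that ends before
  -- the parent of v is topmost at its right end, and dually for black.
  white-child-parent : ∀ {v p x} → Parent v p → v < p → v < x → x < p → (v , x) ∈ D → Parent x v
  white-child-parent {v} {p} {x} pv v<p v<x x<p a with cond3 v x a (λ eq → case subst (1 ≤_) (cong proj₁ eq) (proj₁ (proj₁ pv)) of λ ())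
  ... | inj₁ (tl , _) = ⊥-elim (tl (p , x<p , parent-arc< pv v<p))
  ... | inj₂ (_ , tr) = (≤-trans (proj₁ (proj₁ pv)) (<⇒≤ v<x) , s≤s⁻¹ (<-≤-trans x<p (parent-bound pv))) , inj₂ (v<x , a , tr)

  black-child-parent : ∀ {x q y} → Parent x q → q < x → q < y → y < x → (y , x) ∈ D → Parent y x
  black-child-parent {x} {q} {y} px q<x q<y y<x a with cond3 y x a (λ eq → case subst (q <_) (cong proj₁ eq) q<y of λ ())
  ... | inj₂ (_ , tr) = ⊥-elim (tr (q , q<y , parent-arc> px q<x))
  ... | inj₁ (tl , _) = (≤-trans (s≤s z≤n) q<y , ≤-trans (<⇒≤ y<x) (proj₂ (proj₁ px))) , inj₁ (y<x , a , tl)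

  mutual
    inv-white : ∀ v k → Parent v (v + suc k) → ∀ {e} → e ∈ entries (v + suc k) (whiteTree v k) → EntryInv e
    inv-white v k p (here refl) = p , inj₁ (v , k , refl , refl)
    inv-white v k p (there e∈) = inv-whiteKids v k k ≤-refl p e∈
    inv-whiteKids : ∀ v k j → j ≤ k → Parent v (v + suc k) → ∀ {e} → e ∈ entriesF v (whiteKids v j) → EntryInv e
    inv-whiteKids v k zero _ p ()
    inv-whiteKids v k (suc j) j≤k p e∈ with m v (v + suc j) in eq
    ... | false = inv-whiteKids v k j (≤-trans (n≤1+n j) j≤k) p e∈
    ... | true with ∈-++⁻ (entries v (blackTree v j)) e∈
    ...   | inj₁ x = inv-black v j (white-child-parent p (m<m+1+n v k) (m<m+1+n v j) (+-monoʳ-< v (s≤s j≤k)) (oracle⇒∈ eq)) x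
    ...   | inj₂ y = inv-whiteKids v k j (≤-trans (n≤1+n j) j≤k) p y
    inv-black : ∀ q k → Parent (q + suc k) q → ∀ {e} → e ∈ entries q (blackTree q k) → EntryInv e
    inv-black q k p (here refl) = p , inj₂ (k , refl)
    inv-black q k p (there e∈) = inv-blackKids (q + suc k) q 0 k refl p e∈
    inv-blackKids : ∀ x q i r → q + suc (i + r) ≡ x → Parent x q → ∀ {e} → e ∈ entriesF x (blackKids x q i r) → EntryInv e
    inv-blackKids x q i zero _ _ ()
    inv-blackKids x q i (suc r) inv p {e} e∈ with m (q + suc i) x in eq
    ... | false = inv-blackKids x q (suc i) r (trans (cong (λ z → q + suc z) (sym (+-suc i r))) inv) p e∈
    ... | true with ∈-++⁻ (entries x (whiteTree (q + suc i) r)) e∈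
    ...   | inj₂ z = inv-blackKids x q (suc i) r (trans (cong (λ z → q + suc z) (sym (+-suc i r))) inv) p z
    ...   | inj₁ z = inv-white (q + suc i) r (subst (Parent (q + suc i)) (sym inv1) pc) (subst (λ w → e ∈ entries w (whiteTree (q + suc i) r)) (sym inv1) z)
      where
      inv1 : q + suc i + suc r ≡ x
      inv1 = trans (+-assoc q (suc i) (suc r)) inv
      q<x : q < x
      q<x = subst (q <_) inv (m<m+n q (s≤s z≤n))
      pc : Parent (q + suc i) x
      pc = black-child-parent p q<x (m<m+n q (s≤s z≤n)) (subst (_ <_) inv1 (m<m+n (q + suc i) (s≤s z≤n))) (oracle⇒∈ eq)

  F' : List PTree
  F' = ψ n

  P' : List Entry
  P' = entriesR n F'



  parent-whiteRoot : ∀ i → i < n → m (suc i) (suc n) ≡ true → Parent (suc i) (suc n)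
  parent-whiteRoot i i<n mt = (s≤s z≤n , i<n) , inj₁ (s≤s i<n , oracle⇒∈ mt , topmostLeft-top)

  parent-blackRoot : ∀ i → i < n → m 0 (suc i) ≡ true → Parent (suc i) 0
  parent-blackRoot i i<n mt = (s≤s z≤n , i<n) , inj₂ (s≤s z≤n , oracle⇒∈ mt , λ { (k , () , _) })

  entry-inv : ∀ {e} → e ∈ P' → EntryInv e
  entry-inv {e} e∈ with entriesR-split F' e∈
  ... | t , t∈ , e∈' with ψ-∈⁻ n (upTo n) t∈
  ...   | i , i∈ , inj₁ (refl , mt) =
    inv-white (suc i) (n ∸ suc i) (subst (Parent (suc i)) (suc-split i (∈-upTo⁻ i∈)) (parent-whiteRoot i (∈-upTo⁻ i∈) mt))
         (subst (λ w → e ∈ entries w (whiteTree (suc i) (n ∸ suc i))) (suc-split i (∈-upTo⁻ i∈)) e∈')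
  ...   | i , i∈ , inj₂ (refl , mt) = inv-black 0 i (parent-blackRoot i (∈-upTo⁻ i∈) mt) e∈'

  shape-arc : ∀ {p s} → Shape p s → (root s < p × arcOf (p , s) ≡ (root s , p)) ⊎ (p < root s × arcOf (p , s) ≡ (p , root s))
  shape-arc (inj₁ (v , k , refl , refl)) = inj₁ (m<m+1+n v k , refl)
  shape-arc {p} (inj₂ (k , refl)) = inj₂ (m<m+n p (s≤s z≤n) , refl)

  entry-arc∈D : ∀ {e} → EntryInv e → arcOf e ∈ D
  entry-arc∈D {p , s} (pd , sh) with shape-arc sh
  ... | inj₁ (lt , eq) = subst (_∈ D) (sym eq) (parent-arc< pd lt)
  ... | inj₂ (lt , eq) = subst (_∈ D) (sym eq) (parent-arc> pd lt)

  parent-topmostLeft : ∀ {x y} → Parent x y → x < y → TL x y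
  parent-topmostLeft (_ , inj₁ (_ , _ , tl)) _ = tl
  parent-topmostLeft (_ , inj₂ (y<x , _)) x<y = ⊥-elim (<-asym x<y y<x)

  parent-topmostRight : ∀ {x y} → Parent x y → y < x → TR y x
  parent-topmostRight (_ , inj₂ (_ , _ , tr)) _ = tr
  parent-topmostRight (_ , inj₁ (x<y , _)) y<x = ⊥-elim (<-asym x<y y<x)

  parent-antisym : ∀ {a b} → Parent a b → Parent b a → ⊥
  parent-antisym {a} {b} p q = <-irrefl (∣-∣-comm a b) (parent-dist-grows p q)

  cover-white-root : ∀ v → Parent v (suc n) → ∃[ s ] ((suc n , s) ∈ P' × root s ≡ v)
  cover-white-root zero ((() , _) , _)
  cover-white-root (suc i) p@((_ , le) , _) =
    whiteTree (suc i) (n ∸ suc i) ,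
    root-entry {n} {F'} (ψ-∈-white n (upTo n) (∈-upTo⁺ le) (∈⇒oracle (parent-arc< p (s≤s le)))) , refl

  cover-black-root : ∀ v → Parent v 0 → ∃[ s ] ((0 , s) ∈ P' × root s ≡ v)
  cover-black-root zero ((() , _) , _)
  cover-black-root (suc i) p@((_ , le) , _) =
    blackTree 0 i , root-entry {n} {F'} (ψ-∈-black n (upTo n) (∈-upTo⁺ le) (∈⇒oracle (parent-arc> p (s≤s z≤n)))) , refl

  child-of-white : ∀ {v u k z} → Parent v u → z ≡ u + suc k → (z , whiteTree u k) ∈ P' →
                   ∃[ s ] ((u , s) ∈ P' × root s ≡ v)
  child-of-white {v} {u} {k} p refl e∈ = blackTree u j , child-entryR {n} {F'} e∈ c∈ , eqv
    where
    puz : Parent u (u + suc k)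
    puz = proj₁ (entry-inv e∈)
    a∈ : (u , v) ∈ D
    a∈ with <-cmp v u
    ... | tri< v<u _ _ = ⊥-elim (cond1 v u (u + suc k) (parent-arc< p v<u) (parent-arc< puz (m<m+1+n u k)))
    ... | tri≈ _ refl _ = ⊥-elim (parent-irrefl p)
    ... | tri> _ _ u<v = parent-arc> p u<v
    u<v : u < v
    u<v = proj₁ (arc-bound a∈)
    v<z : v < u + suc k
    v<z = ≤∧≢⇒< (≮⇒≥ (λ z<v → parent-topmostLeft puz (m<m+1+n u k) (v , z<v , a∈)))
                (λ { refl → parent-antisym p puz })
    j : ℕ
    j = v ∸ suc u
    eqv : u + suc j ≡ v
    eqv = +-∸-suc u v u<v
    j<k : j < k
    j<k = s<s⁻¹ (+-cancelˡ-< u (suc j) (suc k) (subst (_< u + suc k) (sym eqv) v<z))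
    c∈ : blackTree u j ∈ whiteKids u k
    c∈ = whiteKids-complete u k j j<k (∈⇒oracle (subst (λ w → (u , w) ∈ D) (sym eqv) a∈))

  child-of-black : ∀ {v u z k} → Parent v u → z + suc k ≡ u → (z , blackTree z k) ∈ P' →
                   ∃[ s ] ((u , s) ∈ P' × root s ≡ v)
  child-of-black {v} {u} {z} {k} p refl e∈ =
    whiteTree (z + suc j) r' , child-entryR {n} {F'} {z} {blackTree z k} e∈ c∈ , eqv
    where
    puz : Parent u z
    puz = proj₁ (entry-inv e∈)
    zu : z < u
    zu = m<m+n z (s≤s z≤n)
    a∈ : (v , u) ∈ D
    a∈ with <-cmp v u
    ... | tri> _ _ u<v = ⊥-elim (cond1 z u v (parent-arc> puz zu) (parent-arc> p u<v))
    ... | tri≈ _ refl _ = ⊥-elim (parent-irrefl p)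
    ... | tri< v<u _ _ = parent-arc< p v<u
    v<u : v < u
    v<u = proj₁ (arc-bound a∈)
    z<v : z < v
    z<v = ≤∧≢⇒< (≮⇒≥ (λ v<z → parent-topmostRight puz zu (v , v<z , a∈)))
                (λ eq → parent-antisym p (subst (Parent u) eq puz))
    j : ℕ
    j = v ∸ suc z
    eqv : z + suc j ≡ v
    eqv = +-∸-suc z v z<v
    j<k : j < k
    j<k = s<s⁻¹ (+-cancelˡ-< z (suc j) (suc k) (subst (_< u) (sym eqv) v<u))
    kbm : ∃[ r' ] (whiteTree (z + suc j) r' ∈ blackKids u z 0 k)
    kbm = blackKids-complete u z 0 k j z≤n j<k (∈⇒oracle (subst (λ a → (a , u) ∈ D) (sym eqv) a∈))
    r' : ℕ
    r' = proj₁ kbm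
    c∈ : whiteTree (z + suc j) r' ∈ blackKids u z 0 k
    c∈ = proj₂ kbm

  -- Induction on f bounding n+1 − |v − u|: the distance
  -- to the parent grows going up, so the parent u (if not 0 or n+1) is
  -- covered first, and v is then found among the children of its tree.
  cover : ∀ f v u → suc n ∸ ∣ v - u ∣ ≤ f → Parent v u → ∃[ s ] ((u , s) ∈ P' × root s ≡ v)
  cover f v u le p with u ≟ suc n
  ... | yes refl = cover-white-root v p
  ... | no u≢ with u ≟ 0
  ...   | yes refl = cover-black-root v p
  ...   | no u≢0 = cover-inner f le
    where
    u≤n : u ≤ n
    u≤n = s≤s⁻¹ (≤∧≢⇒< (parent-bound p) u≢)
    zp : ∃[ z ] Parent u z
    zp = parent-exists u (n≢0⇒n>0 u≢0) u≤n
    z : ℕ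
    z = proj₁ zp
    puz : Parent u z
    puz = proj₂ zp
    lt : ∣ v - u ∣ < ∣ u - z ∣
    lt = parent-dist-grows p puz
    bnd : ∣ u - z ∣ ≤ suc n
    bnd = ≤-trans (∣m-n∣≤m⊔n u z) (⊔-lub (m≤n⇒m≤1+n u≤n) (parent-bound puz))
    cover-inner : ∀ f → suc n ∸ ∣ v - u ∣ ≤ f → ∃[ s ] ((u , s) ∈ P' × root s ≡ v)
    cover-inner zero le0 = ⊥-elim (<-irrefl refl (<-≤-trans (<-≤-trans lt bnd) (m∸n≡0⇒m≤n (n≤0⇒n≡0 le0))))
    cover-inner (suc f') le1 with cover f' u z (s≤s⁻¹ (<-≤-trans (∸-monoʳ-< lt bnd) le1)) puz
    ... | s , e∈ , ru with entry-inv e∈ | ru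
    ...   | _ , inj₁ (u' , k , refl , zeq) | refl = child-of-white p zeq e∈
    ...   | _ , inj₂ (k , refl) | _ = child-of-black p ru e∈

  parent-entry-ψ : ∀ {v u} → Parent v u → ∃[ s ] ((u , s) ∈ P' × root s ≡ v)
  parent-entry-ψ {v} {u} = cover (suc n) v u (m∸n≤m (suc n) ∣ v - u ∣)

  alt-ψ : ∀ {t} → t ∈ F' → AltTree t
  alt-ψ t∈ with ψ-∈⁻ n (upTo n) t∈
  ... | i , _ , inj₁ (refl , _) = proj₁ (alt-whiteTree (suc i) (n ∸ suc i))
  ... | i , _ , inj₂ (refl , _) = proj₁ (alt-blackTree 0 i)

  All-alt-ψ : All AltTree F'
  All-alt-ψ = All.tabulate alt-ψ


  entry-parent : ∀ {e} → e ∈ P' → Parent (label e) (proj₁ e)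
  entry-parent e∈ = proj₁ (entry-inv e∈)

  mutual
    anc-labels : ∀ q t → (∀ {e} → e ∈ entries q t → e ∈ P') → ∀ {z} → z ∈ labels t → Anc (root t) z
    anc-labels q (node c l ts) sub (here refl) = self
    anc-labels q (node c l ts) sub (there z∈) = anc-labelsF l ts (λ x → sub (there x)) z∈
    anc-labelsF : ∀ l ts → (∀ {e} → e ∈ entriesF l ts → e ∈ P') → ∀ {z} → z ∈ labelsF ts → Anc l z
    anc-labelsF l (t ∷ ts) sub z∈ with ∈-++⁻ (labels t) z∈
    ... | inj₁ a = anc-trans (up (entry-parent (sub (∈-++⁺ˡ (head-entry l t)))) self) (anc-labels l t (λ x → sub (∈-++⁺ˡ x)) a)
    ... | inj₂ b = anc-labelsF l ts (λ x → sub (∈-++⁺ʳ (entries l t) x)) b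

  kids-unique : ∀ {t} → AltTree t → Unique (map root (kids t))
  kids-unique (white-node _ _ lk _) = linked⇒unique (λ lt eq → <-irrefl (sym eq) lt) (λ p q → <-trans q p) lk
  kids-unique (black-node _ _ lk _) = linked⇒unique (λ lt eq → <-irrefl eq lt) <-trans lk

  -- The labels of a rebuilt tree are distinct: the root is no label below
  -- it (no point is its own ancestor), and the subtrees of distinct kids
  -- are disjoint.
  mutual
    unique-tree : ∀ q t → AltTree t → (∀ {e} → e ∈ entries q t → e ∈ P') → Unique (labels t)
    unique-tree q (node c l ts) alt sub = All.tabulate root-fresh ∷ unique-treeF l ts (alt-kids alt) (kids-unique alt) (λ x → sub (there x))
      where
      root-fresh : ∀ {z} → z ∈ labelsF ts → l ≢ z
      root-fresh z∈ refl with tree-of-label {ts} z∈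
      ... | t' , t'∈ , z∈' =
        parent-no-loop (entry-parent (sub (there (entries⊆entriesF {l} {t'} {ts} t'∈ (head-entry l t')))))
                       (anc-labels l t' (λ x → sub (there (entries⊆entriesF {l} {t'} {ts} t'∈ x))) z∈')
    unique-treeF : ∀ l ts → All AltTree ts → Unique (map root ts) → (∀ {e} → e ∈ entriesF l ts → e ∈ P') → Unique (labelsF ts)
    unique-treeF l [] _ _ _ = []
    unique-treeF l (t ∷ ts) (at ∷ ats) (d ∷ ds) sub =
      UP.++⁺ (unique-tree l t at (λ x → sub (∈-++⁺ˡ x))) (unique-treeF l ts ats ds (λ x → sub (∈-++⁺ʳ (entries l t) x))) (λ (z1 , z2) → disjoint-subtrees z1 z2)
      where
      disjoint-subtrees : ∀ {z} → z ∈ labels t → z ∈ labelsF ts → ⊥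
      disjoint-subtrees z1 z2 with tree-of-label {ts} z2
      ... | t' , t'∈ , z2' =
        siblings-disjoint (entry-parent (sub (∈-++⁺ˡ (head-entry l t)))) (entry-parent (sub (∈-++⁺ʳ (entries l t) (entries⊆entriesF {l} {t'} {ts} t'∈ (head-entry l t')))))
                (All.lookup d (∈-map⁺ root t'∈)) (anc-labels l t (λ x → sub (∈-++⁺ˡ x)) z1)
                (anc-labels l t' (λ x → sub (∈-++⁺ʳ (entries l t) (entries⊆entriesF {l} {t'} {ts} t'∈ x))) z2')

  rootParent-special : ∀ t → Special (rootParent n t)
  rootParent-special (node white _ _) = inj₂ refl
  rootParent-special (node black _ _) = inj₁ refl

  unique-forest : ∀ G → (∀ {t} → t ∈ G → t ∈ F') → Unique (map root G) → Unique (labelsF G)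
  unique-forest [] _ _ = []
  unique-forest (t ∷ G) sub (d ∷ ds) =
    UP.++⁺ (unique-tree (rootParent n t) t (alt-ψ (sub (here refl))) subE) (unique-forest G (λ x → sub (there x)) ds) (λ (z1 , z2) → disjoint-subtrees z1 z2)
    where
    subE : ∀ {e} → e ∈ entries (rootParent n t) t → e ∈ P'
    subE x = entriesR-sub F' (sub (here refl)) x
    disjoint-subtrees : ∀ {z} → z ∈ labels t → z ∈ labelsF G → ⊥
    disjoint-subtrees z1 z2 with tree-of-label {G} z2
    ... | t' , t'∈ , z2' =
      roots-disjoint (entry-parent (subE (head-entry (rootParent n t) t))) (entry-parent (entriesR-sub F' (sub (there t'∈)) (head-entry (rootParent n t') t')))
             (rootParent-special t) (rootParent-special t') (All.lookup d (∈-map⁺ root t'∈))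
             (anc-labels (rootParent n t) t subE z1) (anc-labels (rootParent n t') t' (entriesR-sub F' (sub (there t'∈))) z2')

  unique-labels-ψ : Unique (labelsF F')
  unique-labels-ψ = unique-forest F' (λ x → x) (unique-roots-ψ n (upTo n) (UP.upTo⁺ n) (λ i e1 e2 → cond1 0 (suc i) (suc n) (oracle⇒∈ e1) (oracle⇒∈ e2)))

  ∈-suc-upTo : ∀ z → 1 ≤ z → z ≤ n → z ∈ map suc (upTo n)
  ∈-suc-upTo (suc z) _ le = ∈-map⁺ suc (∈-upTo⁺ le)

  -- the labels of ψ D are exactly {1,…,n}: they lie between a root and its
  -- virtual parent, and every point of {1,…,n} has a parent, hence an entry
  labels-in-range : ∀ z → z ∈ labelsF F' → z ∈ map suc (upTo n)
  labels-in-range z z∈ with tree-of-label {F'} z∈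
  ... | t , t∈ , z∈t with ψ-∈⁻ n (upTo n) t∈
  ...   | i , i∈ , inj₁ (refl , _) with All.lookup (proj₂ (alt-whiteTree (suc i) (n ∸ suc i))) z∈t
  ...     | a , b = ∈-suc-upTo z (≤-trans (s≤s z≤n) a) (s≤s⁻¹ (subst (z <_) (sym (suc-split i (∈-upTo⁻ i∈))) b))
  labels-in-range z z∈ | t , t∈ , z∈t | i , i∈ , inj₂ (refl , _) with All.lookup (proj₂ (alt-blackTree 0 i)) z∈t
  ...     | a , b = ∈-suc-upTo z a (≤-trans b (∈-upTo⁻ i∈))

  labels-cover : ∀ x → x ∈ map suc (upTo n) → x ∈ labelsF F'
  labels-cover x x∈ with ∈-map⁻ suc x∈
  ... | i , i∈ , refl with parent-exists (suc i) (s≤s z≤n) (∈-upTo⁻ i∈)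
  ...   | u , p with parent-entry-ψ p
  ...     | s , e∈ , rs = subst (_∈ labelsF F') rs (label-of-entry {n} {F'} e∈)

  altForest-ψ : AltForest n F'
  altForest-ψ = All-alt-ψ , unique-sameElements⇒↭ unique-labels-ψ (UP.map⁺ suc-injective (UP.upTo⁺ n)) labels-in-range labels-cover

  φψ⊆D : ∀ {a} → a ∈ φ n F' → a ∈ D
  φψ⊆D a∈ with φ-arc⇒entry n F' All-alt-ψ a∈
  ... | inj₁ refl = top-arc∈
  ... | inj₂ (e , e∈ , eq) = subst (_∈ D) eq (entry-arc∈D (entry-inv e∈))

  parent-arc∈φψ : ∀ {i j} → (i , j) ∈ D → Parent i j ⊎ Parent j i → (i , j) ∈ φ n F'
  parent-arc∈φψ {i} {j} a∈ (inj₁ p) with parent-entry-ψ p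
  ... | s , e∈ , refl with shape-arc (proj₂ (entry-inv e∈))
  ...   | inj₁ (_ , eq) = subst (_∈ φ n F') eq (entry⇒φ-arc n F' All-alt-ψ e∈)
  ...   | inj₂ (j<i , _) = ⊥-elim (<-asym (proj₁ (arc-bound a∈)) j<i)
  parent-arc∈φψ {i} {j} a∈ (inj₂ p) with parent-entry-ψ p
  ... | s , e∈ , refl with shape-arc (proj₂ (entry-inv e∈))
  ...   | inj₂ (_ , eq) = subst (_∈ φ n F') eq (entry⇒φ-arc n F' All-alt-ψ e∈)
  ...   | inj₁ (j<i , _) = ⊥-elim (<-asym (proj₁ (arc-bound a∈)) j<i)

  D⊆φψ : ∀ i j → (i , j) ∈ D → (i , j) ∈ φ n F'
  D⊆φψ i j a∈ with (i , j) ≟A (0 , suc n)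
  ... | yes refl = here refl
  ... | no ne = parent-arc∈φψ a∈ (arc⇒parent a∈ ne)

  φψ≈D : φ n F' ≈A D
  φψ≈D (i , j) = mk⇔ φψ⊆D (D⊆φψ i j)

φ-alternative : ∀ n (F : List PTree) → AltForest n F → AltDiagram n (φ n F)
φ-alternative n F af = ForestToDiagram.altDiag n F af

-- (B) φ is injective up to reordering the trees: both forests are
-- permutations of the reconstruction ψ, which only sees the arc set.
φ-injective : ∀ n (F G : List PTree) → AltForest n F → AltForest n G → φ n F ≈A φ n G → F ↭ G
φ-injective n F G af ag eq =
  ↭-trans (↭-sym (Recover.ψ↭F n F af))
          (↭-trans (↭-reflexive (ψ-resp-≈A eq n)) (Recover.ψ↭F n G ag))

φ-surjective : ∀ n (D : List Arc) → AltDiagram n D → ∃[ F ] (AltForest n F × (φ n F ≈A D))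
φ-surjective n D hD = F' , altForest-ψ , φψ≈D
  where open DiagramToForest n D hD

proposition4p6 : (n : ℕ) →
    ((F : List PTree) → AltForest n F → AltDiagram n (φ n F)) ×
    ((F G : List PTree) → AltForest n F → AltForest n G → φ n F ≈A φ n G → F ↭ G) ×
    ((D : List Arc) → AltDiagram n D → ∃[ F ] (AltForest n F × (φ n F ≈A D)))
proposition4p6 n = φ-alternative n , φ-injective n , φ-surjective n
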